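{- For every integer $n\ge0$, \[ S_n=\rho_{n,0}+\rho_{n,3}\,\zeta_2(5), \] where \[ \rho_{n,0}=-\sum_{i=1}^{4}\sum_{k=0}^{n}\sum_{\ell=1}^{k}\frac{i(i+1)\,r_{n,i,k}}{(\ell-1/2)^{i+2}}\in\mathbb{Q},\qquad \rho_{n,3}=384\sum_{k=0}^{n}r_{n,3,k}\in\mathbb{Q}, \] with the empty sum (for $k=0$) equal to $0$.
   Context: $(a)_m=a(a+1)\cdots(a+m-1)$ is the Pochhammer symbol. For $n\ge0$ let $R_n(t)=2^{8n}(2t+n)\frac{(t+1/2)_n^4}{(t)_{n+1}^4}\in\mathbb{Q}(t)$, which has partial-fraction decomposition $R_n(t)=\sum_{i=1}^4\sum_{k=0}^n \frac{r_{n,i,k}}{(t+k)^i}$ with uniquely determined $r_{n,i,k}\in\mathbb{Q}$. The Volkenborn integral of $f\colon\mathbb{Z}_2\to\mathbb{Q}_2$ is $\int_{\mathbb{Z}_2}f(t)\,dt=\lim_{N\to\infty}2^{ -N}\sum_{k=0}^{2^N-1}f(k)$. Define $S_n:=-\int_{\mathbb{Z}_2}R_n'(t+1/2)\,dt$, where $R_n'$ is the derivative of $R_n$. For an integer $s\ge2$, $\zeta_2(s)=L_2(s,\omega^{1-s})$ (Kubota--Leopoldt $2$-adic $L$-function, $\omega$ Teichmüller), equal to $\frac{1}{4(s-1)}\big(\int_{\mathbb{Z}_2}(1+4t)^{1-s}dt+\int_{\mathbb{Z}_2}(3+4t)^{1-s}dt\big)$. -}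

module Defs where

open import Data.Nat as ℕ using (ℕ; zero; suc; _≤_; _%_)
open import Data.Integer as ℤ using (ℤ; +_; -[1+_])
open import Data.Rational using (ℚ; mkℚ; 0ℚ; 1ℚ; ½; _+_; _*_; _-_; -_; 1/_; _/_)
open import Data.List using (List; []; _∷_)
open import Data.Product using (Σ; ∃; _×_)
open import Relation.Binary.PropositionalEquality using (_≡_; _≢_)

ℕ→ℚ : ℕ → ℚ
ℕ→ℚ n = (+ n) / 1

-- total reciprocal (1/0 := 0; only ever applied to nonzero values below)
inv : ℚ → ℚ
inv (mkℚ (+ zero) _ _) = 0ℚ
inv p@(mkℚ (+ suc _) _ _) = 1/ p
inv p@(mkℚ -[1+ _ ] _ _) = 1/ p

pow : ℚ → ℕ → ℚ
pow q zero = 1ℚ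
pow q (suc m) = q * pow q m

sumTo : ℕ → (ℕ → ℚ) → ℚ
sumTo zero f = 0ℚ
sumTo (suc n) f = sumTo n f + f n

-- Polynomials over ℚ as coefficient lists (constant term first)

Poly : Set
Poly = List ℚ

addP : Poly → Poly → Poly
addP [] q = q
addP (a ∷ p) [] = a ∷ p
addP (a ∷ p) (b ∷ q) = (a + b) ∷ addP p q

scaleP : ℚ → Poly → Poly
scaleP c [] = []
scaleP c (a ∷ p) = (c * a) ∷ scaleP c p

mulP : Poly → Poly → Poly
mulP [] q = []
mulP (a ∷ p) q = addP (scaleP a q) (0ℚ ∷ mulP p q)

evalP : Poly → ℚ → ℚ
evalP [] x = 0ℚ
evalP (a ∷ p) x = a + x * evalP p x

derivAux : ℕ → Poly → Poly
derivAux m [] = []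
derivAux m (a ∷ p) = (ℕ→ℚ m * a) ∷ derivAux (suc m) p

derivP : Poly → Poly
derivP [] = []
derivP (a ∷ p) = derivAux 1 p

powP : Poly → ℕ → Poly
powP p zero = 1ℚ ∷ []
powP p (suc m) = mulP p (powP p m)

prodP : ℕ → (ℕ → Poly) → Poly
prodP zero f = 1ℚ ∷ []
prodP (suc n) f = mulP (prodP n f) (f n)

lin : ℚ → Poly
lin a = a ∷ 1ℚ ∷ []

-- R_n(t) = 2^{8n} (2t+n) (t+1/2)_n^4 / (t)_{n+1}^4  as numerator / denominator

numR : ℕ → Poly
numR n = scaleP (pow (ℕ→ℚ 2) (8 ℕ.* n))
           (mulP (ℕ→ℚ n ∷ ℕ→ℚ 2 ∷ [])
                 (powP (prodP n (λ j → lin (½ + ℕ→ℚ j))) 4))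

denR : ℕ → Poly
denR n = powP (prodP (suc n) (λ j → lin (ℕ→ℚ j))) 4

Rn : ℕ → ℚ → ℚ
Rn n x = evalP (numR n) x * inv (evalP (denR n) x)

Rn′ : ℕ → ℚ → ℚ
Rn′ n x =
  (evalP (derivP (numR n)) x * evalP (denR n) x
     - evalP (numR n) x * evalP (derivP (denR n)) x)
  * inv (pow (evalP (denR n) x) 2)

-- Partial fractions: r i k is the coefficient of 1/(t+k)^i (1 ≤ i ≤ 4, 0 ≤ k ≤ n)

IsPartialFraction : ℕ → (ℕ → ℕ → ℚ) → Set
IsPartialFraction n r =
  (t : ℚ) → ((k : ℕ) → k ≤ n → t + ℕ→ℚ k ≢ 0ℚ) →
  Rn n t ≡ sumTo 4 (λ i′ → sumTo (suc n) (λ k →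
              r (suc i′) k * inv (pow (t + ℕ→ℚ k) (suc i′))))

-- v_2(q) ≥ m :  q * b = a * 2^m  for some integer a and odd natural b
Val2≥ : ℕ → ℚ → Set
Val2≥ m q = Σ ℤ λ a → Σ ℕ λ b → (b % 2 ≡ 1) × (q * ℕ→ℚ b ≡ (a / 1) * pow (ℕ→ℚ 2) m)

Tends0₂ : (ℕ → ℚ) → Set
Tends0₂ u = (m : ℕ) → ∃ λ N₀ → (N : ℕ) → N₀ ≤ N → Val2≥ m (u N)

-- Volkenborn Riemann sums:  2^{-N} Σ_{k<2^N} f(k)
volkSum : (ℕ → ℚ) → ℕ → ℚ
volkSum f N = inv (pow (ℕ→ℚ 2) N) * sumTo (2 ℕ.^ N) f

-- N-th approximant of S_n = - ∫_{Z_2} R_n'(t+1/2) dt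
SnApprox : ℕ → ℕ → ℚ
SnApprox n N = - volkSum (λ k → Rn′ n (ℕ→ℚ k + ½)) N

-- N-th approximant of ζ_2(5) = (1/16)(∫(1+4t)^{-4} dt + ∫(3+4t)^{-4} dt)
zeta5Approx : ℕ → ℚ
zeta5Approx N =
  inv (ℕ→ℚ 16) *
  (volkSum (λ k → inv (pow (ℕ→ℚ (1 ℕ.+ 4 ℕ.* k)) 4)) N
   + volkSum (λ k → inv (pow (ℕ→ℚ (3 ℕ.+ 4 ℕ.* k)) 4)) N)

rho0 : ℕ → (ℕ → ℕ → ℚ) → ℚ
rho0 n r = - sumTo 4 (λ i′ → sumTo (suc n) (λ k → sumTo k (λ ℓ′ →
    ℕ→ℚ (suc i′ ℕ.* (suc i′ ℕ.+ 1)) * r (suc i′) k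
      * inv (pow (ℕ→ℚ (suc ℓ′) - ½) (suc i′ ℕ.+ 2)))))

rho3 : ℕ → (ℕ → ℕ → ℚ) → ℚ
rho3 n r = ℕ→ℚ 384 * sumTo (suc n) (λ k → r 3 k)

-- At t = x + ½ the partial fractions give −R_n′(t) = Σ_{i,k} i 2^{i+1} r_{n,i,k} (2(x+k)+1)^{−i−1}, so the
-- N-th approximant of S_n is a combination of the means 2^{−N} Σ_{y<2^N} (2(y+k)+1)^{−m}, m = i + 1.
-- Shifting y by k changes such a mean by the finite sum 2m Σ_{ℓ<k} (2ℓ+1)^{−m−1}, which assembles into
-- ρ_{n,0}, plus an error of 2-adic valuation ≥ N.  The unshifted means tend to 0 for odd m (pair y with
-- 2^N − 1 − y); for m = 4 consecutive means differ by O(2^N), and the approximant of ζ₂(5) is such a mean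
-- divided by 8; for m = 2 the coefficient Σ_k r_{n,1,k} vanishes because t R_n(t) → 0 as t → ∞ 2-adically.
-- Limits are handled through explicit valuation bounds, and the formula for R_n′ at half-integers is
-- obtained by comparing 2-adic difference quotients along h = 2^M.

module Submission where

open import Defs
open import Data.Nat using (ℕ)
open import Data.Rational using (ℚ; _+_; _*_; _-_)
open import Data.Nat as ℕ using (zero; suc; _∸_; _%_; _^_; _⊔_; _≤_; _<_; z≤n; s≤s)
import Data.Nat.Properties as ℕP
import Data.Nat.DivMod as ℕD
open import Data.Nat.Divisibility as ℕDiv using (_∣_)
open import Data.Nat.Induction using (<-rec)
open import Data.Integer as ℤ using (ℤ; ∣_∣)
import Data.Integer.Properties as ℤP
open import Data.Rational using (mkℚ; 0ℚ; 1ℚ; ½; -_; _/_; ↥_; ↧ₙ_; toℚᵘ)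
import Data.Rational.Properties as ℚP
import Data.Rational.Unnormalised as ℚᵘ
import Data.Rational.Unnormalised.Properties as ℚᵘP
open import Data.Rational.Solver using (module +-*-Solver)
open import Algebra.Bundles using (CommutativeMonoid)
import Algebra.Properties.CommutativeSemigroup as CommSemigroupProperties
open import Data.List using (_∷_; [])
open import Data.Product using (∃; _×_; _,_; proj₁; proj₂)
open import Data.Empty using (⊥-elim)
open import Relation.Nullary using (yes; no)
open import Relation.Binary.PropositionalEquality
open ≡-Reasoning
open +-*-Solver
module ℚ* = CommSemigroupProperties (CommutativeMonoid.commutativeSemigroup ℚP.*-1-commutativeMonoid)
module ℚ+ = CommSemigroupProperties (CommutativeMonoid.commutativeSemigroup ℚP.+-0-commutativeMonoid)

ℤ→ℚ : ℤ → ℚ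
ℤ→ℚ z = z / 1

ℤ→ℚ≃mkℚᵘ : ∀ z → toℚᵘ (ℤ→ℚ z) ℚᵘ.≃ ℚᵘ.mkℚᵘ z 0
ℤ→ℚ≃mkℚᵘ z = ℚP.toℚᵘ-fromℚᵘ (ℚᵘ.mkℚᵘ z 0)

ℤ→ℚ-+ : ∀ a b → ℤ→ℚ (a ℤ.+ b) ≡ ℤ→ℚ a + ℤ→ℚ b
ℤ→ℚ-+ a b = ℚP.toℚᵘ-injective (ℚᵘP.≃-trans (ℤ→ℚ≃mkℚᵘ (a ℤ.+ b)) (ℚᵘP.≃-sym (ℚᵘP.≃-trans
  (ℚP.toℚᵘ-homo-+ (ℤ→ℚ a) (ℤ→ℚ b))
  (ℚᵘP.≃-trans (ℚᵘP.+-cong (ℤ→ℚ≃mkℚᵘ a) (ℤ→ℚ≃mkℚᵘ b))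
    (ℚᵘ.*≡* (cong₂ ℤ._*_ (cong₂ ℤ._+_ (ℤP.*-identityʳ a) (ℤP.*-identityʳ b)) refl))))))

ℤ→ℚ-* : ∀ a b → ℤ→ℚ (a ℤ.* b) ≡ ℤ→ℚ a * ℤ→ℚ b
ℤ→ℚ-* a b = ℚP.toℚᵘ-injective (ℚᵘP.≃-trans (ℤ→ℚ≃mkℚᵘ (a ℤ.* b)) (ℚᵘP.≃-sym (ℚᵘP.≃-trans
  (ℚP.toℚᵘ-homo-* (ℤ→ℚ a) (ℤ→ℚ b))
  (ℚᵘP.≃-trans (ℚᵘP.*-cong (ℤ→ℚ≃mkℚᵘ a) (ℤ→ℚ≃mkℚᵘ b)) (ℚᵘ.*≡* refl)))))

ℤ→ℚ-neg : ∀ a → ℤ→ℚ (ℤ.- a) ≡ - ℤ→ℚ a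
ℤ→ℚ-neg a = ℚP.toℚᵘ-injective (ℚᵘP.≃-trans (ℤ→ℚ≃mkℚᵘ (ℤ.- a)) (ℚᵘP.≃-sym (ℚᵘP.≃-trans
  (ℚP.toℚᵘ-homo‿- (ℤ→ℚ a))
  (ℚᵘP.≃-trans (ℚᵘP.-‿cong (ℤ→ℚ≃mkℚᵘ a)) (ℚᵘ.*≡* refl)))))

ℤ→ℚ-injective : ∀ {a b} → ℤ→ℚ a ≡ ℤ→ℚ b → a ≡ b
ℤ→ℚ-injective {a} {b} e
  with ℚᵘP.≃-trans (ℚᵘP.≃-sym (ℤ→ℚ≃mkℚᵘ a)) (ℚᵘP.≃-trans (ℚᵘP.≃-reflexive (cong toℚᵘ e)) (ℤ→ℚ≃mkℚᵘ b))
... | ℚᵘ.*≡* a*1≡b*1 = trans (sym (ℤP.*-identityʳ a)) (trans a*1≡b*1 (ℤP.*-identityʳ b))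

ℕ→ℚ-+ : ∀ a b → ℕ→ℚ (a ℕ.+ b) ≡ ℕ→ℚ a + ℕ→ℚ b
ℕ→ℚ-+ a b = trans (cong ℤ→ℚ (ℤP.pos-+ a b)) (ℤ→ℚ-+ (ℤ.+ a) (ℤ.+ b))

ℕ→ℚ-* : ∀ a b → ℕ→ℚ (a ℕ.* b) ≡ ℕ→ℚ a * ℕ→ℚ b
ℕ→ℚ-* a b = trans (cong ℤ→ℚ (ℤP.pos-* a b)) (ℤ→ℚ-* (ℤ.+ a) (ℤ.+ b))

ℕ→ℚ-suc : ∀ a → ℕ→ℚ (suc a) ≡ 1ℚ + ℕ→ℚ a
ℕ→ℚ-suc = ℕ→ℚ-+ 1

ℕ→ℚ-^ : ∀ a m → ℕ→ℚ (a ^ m) ≡ pow (ℕ→ℚ a) m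
ℕ→ℚ-^ a zero = refl
ℕ→ℚ-^ a (suc m) = trans (ℕ→ℚ-* a (a ^ m)) (cong (ℕ→ℚ a *_) (ℕ→ℚ-^ a m))

ℕ→ℚ-suc≢0 : ∀ a → ℕ→ℚ (suc a) ≢ 0ℚ
ℕ→ℚ-suc≢0 a e with ℤ→ℚ-injective {ℤ.+ suc a} {ℤ.+ 0} e
... | ()

pow-+ : ∀ q a b → pow q (a ℕ.+ b) ≡ pow q a * pow q b
pow-+ q zero b = sym (ℚP.*-identityˡ _)
pow-+ q (suc a) b = trans (cong (q *_) (pow-+ q a b)) (sym (ℚP.*-assoc q _ _))

pow-distrib-* : ∀ p q m → pow (p * q) m ≡ pow p m * pow q m
pow-distrib-* p q zero = refl
pow-distrib-* p q (suc m) = trans (cong ((p * q) *_) (pow-distrib-* p q m)) (ℚ*.interchange p q (pow p m) (pow q m))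

pow-1ℚ : ∀ m → pow 1ℚ m ≡ 1ℚ
pow-1ℚ zero = refl
pow-1ℚ (suc m) = trans (ℚP.*-identityˡ _) (pow-1ℚ m)

pow-neg-odd : ∀ q k → pow (- q) (suc (2 ℕ.* k)) ≡ - pow q (suc (2 ℕ.* k))
pow-neg-odd q zero = solve 1 (λ q → :- q :* con 1ℚ := :- (q :* con 1ℚ)) refl q
pow-neg-odd q (suc k) = begin
  pow (- q) (suc (2 ℕ.* suc k))            ≡⟨ cong (λ e → pow (- q) (suc e)) (ℕP.*-suc 2 k) ⟩
  - q * (- q * pow (- q) (suc (2 ℕ.* k)))  ≡⟨ cong (λ z → - q * (- q * z)) (pow-neg-odd q k) ⟩
  - q * (- q * - pow q (suc (2 ℕ.* k)))    ≡⟨ lemma q (pow q (suc (2 ℕ.* k))) ⟩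
  - (q * (q * pow q (suc (2 ℕ.* k))))      ≡⟨ cong (λ e → - pow q (suc e)) (sym (ℕP.*-suc 2 k)) ⟩
  - pow q (suc (2 ℕ.* suc k))              ∎
  where
  lemma : ∀ a b → - a * (- a * - b) ≡ - (a * (a * b))
  lemma = solve 2 (λ a b → :- a :* (:- a :* :- b) := :- (a :* (a :* b))) refl

*-invʳ : ∀ q → q ≢ 0ℚ → q * inv q ≡ 1ℚ
*-invʳ q@(mkℚ (ℤ.+ zero) _ _) q≢0 = ⊥-elim (q≢0 (ℚP.↥p≡0⇒p≡0 q refl))
*-invʳ q@(mkℚ (ℤ.+ suc _) _ _) _ = ℚP.*-inverseʳ q
*-invʳ q@(mkℚ ℤ.-[1+ _ ] _ _) _ = ℚP.*-inverseʳ q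

*-invˡ : ∀ q → q ≢ 0ℚ → inv q * q ≡ 1ℚ
*-invˡ q q≢0 = trans (ℚP.*-comm (inv q) q) (*-invʳ q q≢0)

*-cancelˡ : ∀ a {x y} → a ≢ 0ℚ → a * x ≡ a * y → x ≡ y
*-cancelˡ a {x} {y} a≢0 e = begin
  x                ≡⟨ sym (ℚP.*-identityˡ x) ⟩
  1ℚ * x           ≡⟨ cong (_* x) (sym (*-invˡ a a≢0)) ⟩
  (inv a * a) * x  ≡⟨ ℚP.*-assoc (inv a) a x ⟩
  inv a * (a * x)  ≡⟨ cong (inv a *_) e ⟩
  inv a * (a * y)  ≡⟨ sym (ℚP.*-assoc (inv a) a y) ⟩
  (inv a * a) * y  ≡⟨ cong (_* y) (*-invˡ a a≢0) ⟩
  1ℚ * y           ≡⟨ ℚP.*-identityˡ y ⟩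
  y                ∎

*-≢0 : ∀ {p q} → p ≢ 0ℚ → q ≢ 0ℚ → p * q ≢ 0ℚ
*-≢0 {p} p≢0 q≢0 pq≡0 = q≢0 (*-cancelˡ p p≢0 (trans pq≡0 (sym (ℚP.*-zeroʳ p))))

pow-≢0 : ∀ {p} m → p ≢ 0ℚ → pow p m ≢ 0ℚ
pow-≢0 zero p≢0 ()
pow-≢0 (suc m) p≢0 = *-≢0 p≢0 (pow-≢0 m p≢0)

inv-unique : ∀ p q → p * q ≡ 1ℚ → inv p ≡ q
inv-unique p q pq≡1 = *-cancelˡ p p≢0 (trans (*-invʳ p p≢0) (sym pq≡1))
  where
  p≢0 : p ≢ 0ℚ
  p≢0 p≡0 = ℚP.1≢0 (trans (sym pq≡1) (trans (cong (_* q) p≡0) (ℚP.*-zeroˡ q)))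

inv-* : ∀ p q → p ≢ 0ℚ → q ≢ 0ℚ → inv (p * q) ≡ inv p * inv q
inv-* p q p≢0 q≢0 = inv-unique (p * q) (inv p * inv q) (begin
  (p * q) * (inv p * inv q)  ≡⟨ ℚ*.interchange p q (inv p) (inv q) ⟩
  (p * inv p) * (q * inv q)  ≡⟨ cong₂ _*_ (*-invʳ p p≢0) (*-invʳ q q≢0) ⟩
  1ℚ                         ∎)

inv-pow : ∀ p m → p ≢ 0ℚ → inv (pow p m) ≡ pow (inv p) m
inv-pow p m p≢0 = inv-unique (pow p m) (pow (inv p) m) (begin
  pow p m * pow (inv p) m  ≡⟨ sym (pow-distrib-* p (inv p) m) ⟩
  pow (p * inv p) m        ≡⟨ cong (λ z → pow z m) (*-invʳ p p≢0) ⟩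
  pow 1ℚ m                 ≡⟨ pow-1ℚ m ⟩
  1ℚ                       ∎)

inv-neg : ∀ q → inv (- q) ≡ - inv q
inv-neg q with q ℚP.≟ 0ℚ
... | yes refl = refl
... | no q≢0 = inv-unique (- q) (- inv q) (trans (lemma q (inv q)) (*-invʳ q q≢0))
  where
  lemma : ∀ a b → - a * - b ≡ a * b
  lemma = solve 2 (λ a b → :- a :* :- b := a :* b) refl

sumTo-cong : ∀ n {f g : ℕ → ℚ} → (∀ k → f k ≡ g k) → sumTo n f ≡ sumTo n g
sumTo-cong zero e = refl
sumTo-cong (suc n) e = cong₂ _+_ (sumTo-cong n e) (e n)

sumTo-cong-< : ∀ n {f g : ℕ → ℚ} → (∀ k → k < n → f k ≡ g k) → sumTo n f ≡ sumTo n g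
sumTo-cong-< zero e = refl
sumTo-cong-< (suc n) e =
  cong₂ _+_ (sumTo-cong-< n (λ k k<n → e k (ℕP.m<n⇒m<1+n k<n))) (e n (ℕP.n<1+n n))

sumTo-0 : ∀ n → sumTo n (λ _ → 0ℚ) ≡ 0ℚ
sumTo-0 zero = refl
sumTo-0 (suc n) = trans (ℚP.+-identityʳ _) (sumTo-0 n)

sumTo-1 : ∀ n → sumTo n (λ _ → 1ℚ) ≡ ℕ→ℚ n
sumTo-1 zero = refl
sumTo-1 (suc n) = trans (cong (_+ 1ℚ) (sumTo-1 n)) (trans (ℚP.+-comm (ℕ→ℚ n) 1ℚ) (sym (ℕ→ℚ-suc n)))

sumTo-+ : ∀ n (f g : ℕ → ℚ) → sumTo n (λ k → f k + g k) ≡ sumTo n f + sumTo n g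
sumTo-+ zero f g = refl
sumTo-+ (suc n) f g =
  trans (cong (_+ (f n + g n)) (sumTo-+ n f g)) (ℚ+.interchange (sumTo n f) (sumTo n g) (f n) (g n))

sumTo-*ˡ : ∀ n c (f : ℕ → ℚ) → sumTo n (λ k → c * f k) ≡ c * sumTo n f
sumTo-*ˡ zero c f = sym (ℚP.*-zeroʳ c)
sumTo-*ˡ (suc n) c f =
  trans (cong (_+ c * f n) (sumTo-*ˡ n c f)) (sym (ℚP.*-distribˡ-+ c (sumTo n f) (f n)))

sumTo-neg : ∀ n (f : ℕ → ℚ) → sumTo n (λ k → - f k) ≡ - sumTo n f
sumTo-neg zero f = refl
sumTo-neg (suc n) f =
  trans (cong (_+ - f n) (sumTo-neg n f)) (sym (ℚP.neg-distrib-+ (sumTo n f) (f n)))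

sumTo-- : ∀ n (f g : ℕ → ℚ) → sumTo n (λ k → f k - g k) ≡ sumTo n f - sumTo n g
sumTo-- n f g = trans (sumTo-+ n f (λ k → - g k)) (cong (sumTo n f +_) (sumTo-neg n g))

sumTo-swap : ∀ m n (f : ℕ → ℕ → ℚ) →
  sumTo m (λ i → sumTo n (f i)) ≡ sumTo n (λ k → sumTo m (λ i → f i k))
sumTo-swap zero n f = sym (sumTo-0 n)
sumTo-swap (suc m) n f = begin
  sumTo m (λ i → sumTo n (f i)) + sumTo n (f m)                ≡⟨ cong (_+ sumTo n (f m)) (sumTo-swap m n f) ⟩
  sumTo n (λ k → sumTo m (λ i → f i k)) + sumTo n (f m)        ≡⟨ sym (sumTo-+ n _ (f m)) ⟩
  sumTo n (λ k → sumTo m (λ i → f i k) + f m k)                ∎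

sumTo-++ : ∀ a b (f : ℕ → ℚ) → sumTo (a ℕ.+ b) f ≡ sumTo a f + sumTo b (λ x → f (a ℕ.+ x))
sumTo-++ a zero f = trans (cong (λ z → sumTo z f) (ℕP.+-identityʳ a)) (sym (ℚP.+-identityʳ _))
sumTo-++ a (suc b) f = begin
  sumTo (a ℕ.+ suc b) f                                        ≡⟨ cong (λ z → sumTo z f) (ℕP.+-suc a b) ⟩
  sumTo (a ℕ.+ b) f + f (a ℕ.+ b)                              ≡⟨ cong (_+ f (a ℕ.+ b)) (sumTo-++ a b f) ⟩
  sumTo a f + sumTo b (λ x → f (a ℕ.+ x)) + f (a ℕ.+ b)        ≡⟨ ℚP.+-assoc (sumTo a f) _ _ ⟩
  sumTo a f + (sumTo b (λ x → f (a ℕ.+ x)) + f (a ℕ.+ b))      ∎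

sumTo-sucˡ : ∀ n (f : ℕ → ℚ) → sumTo (suc n) f ≡ f 0 + sumTo n (λ x → f (suc x))
sumTo-sucˡ n f = trans (sumTo-++ 1 n f) (cong (_+ sumTo n (λ x → f (suc x))) (ℚP.+-identityˡ (f 0)))

sumTo-shift : ∀ n k (f : ℕ → ℚ) →
  sumTo n (λ x → f (k ℕ.+ x)) ≡ sumTo n f + sumTo k (λ j → f (j ℕ.+ n) - f j)
sumTo-shift n zero f = sym (ℚP.+-identityʳ _)
sumTo-shift n (suc k) f = begin
  sumTo n (λ x → f (suc k ℕ.+ x))          ≡⟨ sumTo-cong n (λ x → cong f (sym (ℕP.+-suc k x))) ⟩
  sumTo n (λ x → g (suc x))                ≡⟨ lemma₁ (sumTo n (λ x → g (suc x))) (g 0) ⟩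
  g 0 + sumTo n (λ x → g (suc x)) - g 0    ≡⟨ cong (_- g 0) (sym (sumTo-sucˡ n g)) ⟩
  sumTo n g + g n - g 0                    ≡⟨ cong₂ (λ a b → a + g n - f b) (sumTo-shift n k f) (ℕP.+-identityʳ k) ⟩
  sumTo n f + D + f (k ℕ.+ n) - f k        ≡⟨ lemma₂ (sumTo n f) D (f (k ℕ.+ n)) (f k) ⟩
  sumTo n f + (D + (f (k ℕ.+ n) - f k))    ∎
  where
  g : ℕ → ℚ
  g x = f (k ℕ.+ x)
  D = sumTo k (λ j → f (j ℕ.+ n) - f j)
  lemma₁ : ∀ a b → a ≡ b + a - b
  lemma₁ = solve 2 (λ a b → a := b :+ a :- b) refl
  lemma₂ : ∀ a s x y → a + s + x - y ≡ a + (s + (x - y))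
  lemma₂ = solve 4 (λ a s x y → a :+ s :+ x :- y := a :+ (s :+ (x :- y))) refl

sumTo-reverse : ∀ n (f : ℕ → ℚ) → sumTo n f ≡ sumTo n (λ x → f (n ∸ suc x))
sumTo-reverse zero f = refl
sumTo-reverse (suc n) f = begin
  sumTo n f + f n                          ≡⟨ cong (_+ f n) (sumTo-reverse n f) ⟩
  sumTo n (λ x → f (n ∸ suc x)) + f n      ≡⟨ ℚP.+-comm _ (f n) ⟩
  f n + sumTo n (λ x → f (n ∸ suc x))      ≡⟨ sym (sumTo-sucˡ n (λ x → f (n ∸ x))) ⟩
  sumTo (suc n) (λ x → f (n ∸ x))          ∎

sumTo-evenOdd : ∀ n (f : ℕ → ℚ) → sumTo (2 ℕ.* n) f ≡ sumTo n (λ k → f (2 ℕ.* k) + f (suc (2 ℕ.* k)))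
sumTo-evenOdd zero f = refl
sumTo-evenOdd (suc n) f = begin
  sumTo (2 ℕ.* suc n) f
    ≡⟨ cong (λ z → sumTo z f) (ℕP.*-suc 2 n) ⟩
  sumTo (2 ℕ.* n) f + f (2 ℕ.* n) + f (suc (2 ℕ.* n))
    ≡⟨ cong (λ z → z + f (2 ℕ.* n) + f (suc (2 ℕ.* n))) (sumTo-evenOdd n f) ⟩
  S + f (2 ℕ.* n) + f (suc (2 ℕ.* n))
    ≡⟨ ℚP.+-assoc S (f (2 ℕ.* n)) (f (suc (2 ℕ.* n))) ⟩
  S + (f (2 ℕ.* n) + f (suc (2 ℕ.* n))) ∎
  where
  S = sumTo n (λ k → f (2 ℕ.* k) + f (suc (2 ℕ.* k)))

prodTo : ℕ → (ℕ → ℚ) → ℚ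
prodTo zero f = 1ℚ
prodTo (suc n) f = prodTo n f * f n

prodTo-cong : ∀ n {f g : ℕ → ℚ} → (∀ j → f j ≡ g j) → prodTo n f ≡ prodTo n g
prodTo-cong zero e = refl
prodTo-cong (suc n) e = cong₂ _*_ (prodTo-cong n e) (e n)

prodTo-* : ∀ n (f g : ℕ → ℚ) → prodTo n (λ j → f j * g j) ≡ prodTo n f * prodTo n g
prodTo-* zero f g = refl
prodTo-* (suc n) f g =
  trans (cong (_* (f n * g n)) (prodTo-* n f g)) (ℚ*.interchange (prodTo n f) (prodTo n g) (f n) (g n))

prodTo-const : ∀ n c → prodTo n (λ _ → c) ≡ pow c n
prodTo-const zero c = refl
prodTo-const (suc n) c = trans (cong (_* c) (prodTo-const n c)) (ℚP.*-comm (pow c n) c)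

prodTo-≢0 : ∀ n (f : ℕ → ℚ) → (∀ j → j < n → f j ≢ 0ℚ) → prodTo n f ≢ 0ℚ
prodTo-≢0 zero f f≢0 ()
prodTo-≢0 (suc n) f f≢0 =
  *-≢0 (prodTo-≢0 n f (λ j j<n → f≢0 j (ℕP.m<n⇒m<1+n j<n))) (f≢0 n (ℕP.n<1+n n))

inv-prodTo : ∀ n (f : ℕ → ℚ) → (∀ j → j < n → f j ≢ 0ℚ) → inv (prodTo n f) ≡ prodTo n (λ j → inv (f j))
inv-prodTo zero f f≢0 = refl
inv-prodTo (suc n) f f≢0 = trans
  (inv-* (prodTo n f) (f n) (prodTo-≢0 n f f<≢0) (f≢0 n (ℕP.n<1+n n)))
  (cong (_* inv (f n)) (inv-prodTo n f f<≢0))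
  where
  f<≢0 : ∀ j → j < n → f j ≢ 0ℚ
  f<≢0 j j<n = f≢0 j (ℕP.m<n⇒m<1+n j<n)

pow2 : ℕ → ℚ
pow2 = pow (ℕ→ℚ 2)

pow2-≢0 : ∀ k → pow2 k ≢ 0ℚ
pow2-≢0 k = pow-≢0 k (ℕ→ℚ-suc≢0 1)

pow2-*-inv-cancel : ∀ M q → pow2 M * (inv (pow2 M) * q) ≡ q
pow2-*-inv-cancel M q = begin
  pow2 M * (inv (pow2 M) * q)    ≡⟨ sym (ℚP.*-assoc (pow2 M) (inv (pow2 M)) q) ⟩
  pow2 M * inv (pow2 M) * q      ≡⟨ cong (_* q) (*-invʳ (pow2 M) (pow2-≢0 M)) ⟩
  1ℚ * q                         ≡⟨ ℚP.*-identityˡ q ⟩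
  q                              ∎

inv-pow2-*-cancel : ∀ M q → inv (pow2 M) * (pow2 M * q) ≡ q
inv-pow2-*-cancel M q = begin
  inv (pow2 M) * (pow2 M * q)    ≡⟨ sym (ℚP.*-assoc (inv (pow2 M)) (pow2 M) q) ⟩
  inv (pow2 M) * pow2 M * q      ≡⟨ cong (_* q) (*-invˡ (pow2 M) (pow2-≢0 M)) ⟩
  1ℚ * q                         ≡⟨ ℚP.*-identityˡ q ⟩
  q                              ∎

odd-* : ∀ a b → a % 2 ≡ 1 → b % 2 ≡ 1 → (a ℕ.* b) % 2 ≡ 1
odd-* a b a-odd b-odd = trans (ℕD.%-distribˡ-* a b 2) (cong₂ (λ x y → (x ℕ.* y) % 2) a-odd b-odd)

record ℤ₍₂₎ (q : ℚ) : Set where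
  constructor mkℤ₍₂₎
  field
    numerator       : ℤ
    denominator     : ℕ
    denominator-odd : denominator % 2 ≡ 1
    cleared         : q * ℕ→ℚ denominator ≡ ℤ→ℚ numerator

ℤ₍₂₎-ℤ : ∀ z → ℤ₍₂₎ (ℤ→ℚ z)
ℤ₍₂₎-ℤ z = mkℤ₍₂₎ z 1 refl (ℚP.*-identityʳ (ℤ→ℚ z))

ℤ₍₂₎-ℕ : ∀ n → ℤ₍₂₎ (ℕ→ℚ n)
ℤ₍₂₎-ℕ n = ℤ₍₂₎-ℤ (ℤ.+ n)

ℤ₍₂₎-+ : ∀ {p q} → ℤ₍₂₎ p → ℤ₍₂₎ q → ℤ₍₂₎ (p + q)
ℤ₍₂₎-+ {p} {q} (mkℤ₍₂₎ a b b-odd e) (mkℤ₍₂₎ a′ b′ b′-odd e′) =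
  mkℤ₍₂₎ (a ℤ.* ℤ.+ b′ ℤ.+ a′ ℤ.* ℤ.+ b) (b ℕ.* b′) (odd-* b b′ b-odd b′-odd) (begin
    (p + q) * ℕ→ℚ (b ℕ.* b′)                          ≡⟨ cong ((p + q) *_) (ℕ→ℚ-* b b′) ⟩
    (p + q) * (ℕ→ℚ b * ℕ→ℚ b′)                        ≡⟨ lemma p q (ℕ→ℚ b) (ℕ→ℚ b′) ⟩
    p * ℕ→ℚ b * ℕ→ℚ b′ + q * ℕ→ℚ b′ * ℕ→ℚ b           ≡⟨ cong₂ (λ x y → x * ℕ→ℚ b′ + y * ℕ→ℚ b) e e′ ⟩
    ℤ→ℚ a * ℕ→ℚ b′ + ℤ→ℚ a′ * ℕ→ℚ b                   ≡⟨ sym (cong₂ _+_ (ℤ→ℚ-* a (ℤ.+ b′)) (ℤ→ℚ-* a′ (ℤ.+ b))) ⟩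
    ℤ→ℚ (a ℤ.* ℤ.+ b′) + ℤ→ℚ (a′ ℤ.* ℤ.+ b)           ≡⟨ sym (ℤ→ℚ-+ (a ℤ.* ℤ.+ b′) (a′ ℤ.* ℤ.+ b)) ⟩
    ℤ→ℚ (a ℤ.* ℤ.+ b′ ℤ.+ a′ ℤ.* ℤ.+ b)                ∎)
  where
  lemma : ∀ p q x y → (p + q) * (x * y) ≡ p * x * y + q * y * x
  lemma = solve 4 (λ p q x y → (p :+ q) :* (x :* y) := p :* x :* y :+ q :* y :* x) refl

ℤ₍₂₎-* : ∀ {p q} → ℤ₍₂₎ p → ℤ₍₂₎ q → ℤ₍₂₎ (p * q)
ℤ₍₂₎-* {p} {q} (mkℤ₍₂₎ a b b-odd e) (mkℤ₍₂₎ a′ b′ b′-odd e′) =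
  mkℤ₍₂₎ (a ℤ.* a′) (b ℕ.* b′) (odd-* b b′ b-odd b′-odd) (begin
    (p * q) * ℕ→ℚ (b ℕ.* b′)        ≡⟨ cong ((p * q) *_) (ℕ→ℚ-* b b′) ⟩
    (p * q) * (ℕ→ℚ b * ℕ→ℚ b′)      ≡⟨ ℚ*.interchange p q (ℕ→ℚ b) (ℕ→ℚ b′) ⟩
    (p * ℕ→ℚ b) * (q * ℕ→ℚ b′)      ≡⟨ cong₂ _*_ e e′ ⟩
    ℤ→ℚ a * ℤ→ℚ a′                  ≡⟨ sym (ℤ→ℚ-* a a′) ⟩
    ℤ→ℚ (a ℤ.* a′)                  ∎)

ℤ₍₂₎-neg : ∀ {p} → ℤ₍₂₎ p → ℤ₍₂₎ (- p)
ℤ₍₂₎-neg {p} (mkℤ₍₂₎ a b b-odd e) = mkℤ₍₂₎ (ℤ.- a) b b-odd (begin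
  - p * ℕ→ℚ b    ≡⟨ sym (ℚP.neg-distribˡ-* p (ℕ→ℚ b)) ⟩
  - (p * ℕ→ℚ b)  ≡⟨ cong -_ e ⟩
  - ℤ→ℚ a        ≡⟨ sym (ℤ→ℚ-neg a) ⟩
  ℤ→ℚ (ℤ.- a)    ∎)

ℤ₍₂₎-- : ∀ {p q} → ℤ₍₂₎ p → ℤ₍₂₎ q → ℤ₍₂₎ (p - q)
ℤ₍₂₎-- p∈ q∈ = ℤ₍₂₎-+ p∈ (ℤ₍₂₎-neg q∈)

ℤ₍₂₎-pow : ∀ {p} m → ℤ₍₂₎ p → ℤ₍₂₎ (pow p m)
ℤ₍₂₎-pow zero p∈ = ℤ₍₂₎-ℕ 1
ℤ₍₂₎-pow (suc m) p∈ = ℤ₍₂₎-* p∈ (ℤ₍₂₎-pow m p∈)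

ℤ₍₂₎-pow2 : ∀ k → ℤ₍₂₎ (pow2 k)
ℤ₍₂₎-pow2 k = ℤ₍₂₎-pow k (ℤ₍₂₎-ℕ 2)

ℤ₍₂₎-sumTo : ∀ n {f : ℕ → ℚ} → (∀ k → ℤ₍₂₎ (f k)) → ℤ₍₂₎ (sumTo n f)
ℤ₍₂₎-sumTo zero f∈ = ℤ₍₂₎-ℕ 0
ℤ₍₂₎-sumTo (suc n) f∈ = ℤ₍₂₎-+ (ℤ₍₂₎-sumTo n f∈) (f∈ n)

ℤ₍₂₎-prodTo : ∀ n {f : ℕ → ℚ} → (∀ k → ℤ₍₂₎ (f k)) → ℤ₍₂₎ (prodTo n f)
ℤ₍₂₎-prodTo zero f∈ = ℤ₍₂₎-ℕ 1
ℤ₍₂₎-prodTo (suc n) f∈ = ℤ₍₂₎-* (ℤ₍₂₎-prodTo n f∈) (f∈ n)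

ℤ₍₂₎-inv-odd : ∀ b → b % 2 ≡ 1 → ℤ₍₂₎ (inv (ℕ→ℚ b))
ℤ₍₂₎-inv-odd (suc b) b-odd = mkℤ₍₂₎ (ℤ.+ 1) (suc b) b-odd (*-invˡ (ℕ→ℚ (suc b)) (ℕ→ℚ-suc≢0 b))

-- v₂(q) ≥ m − c, with the two indices kept apart to avoid truncated subtraction.
record Val≥ (m c : ℕ) (q : ℚ) : Set where
  constructor mkVal≥
  field
    cofactor          : ℚ
    cofactor-integral : ℤ₍₂₎ cofactor
    factorisation     : pow2 c * q ≡ pow2 m * cofactor

Val≥-ℤ₍₂₎ : ∀ {q} → ℤ₍₂₎ q → Val≥ 0 0 q
Val≥-ℤ₍₂₎ {q} q∈ = mkVal≥ q q∈ refl

Val≥-0 : ∀ {m c} → Val≥ m c 0ℚ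
Val≥-0 {m} {c} = mkVal≥ 0ℚ (ℤ₍₂₎-ℕ 0) (trans (ℚP.*-zeroʳ (pow2 c)) (sym (ℚP.*-zeroʳ (pow2 m))))

Val≥-pow2 : ∀ k → Val≥ k 0 (pow2 k)
Val≥-pow2 k = mkVal≥ 1ℚ (ℤ₍₂₎-ℕ 1) (trans (ℚP.*-identityˡ (pow2 k)) (sym (ℚP.*-identityʳ (pow2 k))))

Val≥-+ : ∀ {m c p q} → Val≥ m c p → Val≥ m c q → Val≥ m c (p + q)
Val≥-+ {m} {c} {p} {q} (mkVal≥ w w∈ e) (mkVal≥ w′ w′∈ e′) = mkVal≥ (w + w′) (ℤ₍₂₎-+ w∈ w′∈)
  (trans (ℚP.*-distribˡ-+ (pow2 c) p q) (trans (cong₂ _+_ e e′) (sym (ℚP.*-distribˡ-+ (pow2 m) w w′))))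

Val≥-neg : ∀ {m c p} → Val≥ m c p → Val≥ m c (- p)
Val≥-neg {m} {c} {p} (mkVal≥ w w∈ e) = mkVal≥ (- w) (ℤ₍₂₎-neg w∈)
  (trans (sym (ℚP.neg-distribʳ-* (pow2 c) p)) (trans (cong -_ e) (ℚP.neg-distribʳ-* (pow2 m) w)))

Val≥-- : ∀ {m c p q} → Val≥ m c p → Val≥ m c q → Val≥ m c (p - q)
Val≥-- p≥ q≥ = Val≥-+ p≥ (Val≥-neg q≥)

Val≥-* : ∀ {m c m′ c′ p q} → Val≥ m c p → Val≥ m′ c′ q → Val≥ (m ℕ.+ m′) (c ℕ.+ c′) (p * q)
Val≥-* {m} {c} {m′} {c′} {p} {q} (mkVal≥ w w∈ e) (mkVal≥ w′ w′∈ e′) = mkVal≥ (w * w′) (ℤ₍₂₎-* w∈ w′∈) (begin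
  pow2 (c ℕ.+ c′) * (p * q)          ≡⟨ cong (_* (p * q)) (pow-+ _ c c′) ⟩
  (pow2 c * pow2 c′) * (p * q)       ≡⟨ ℚ*.interchange (pow2 c) (pow2 c′) p q ⟩
  (pow2 c * p) * (pow2 c′ * q)       ≡⟨ cong₂ _*_ e e′ ⟩
  (pow2 m * w) * (pow2 m′ * w′)      ≡⟨ ℚ*.interchange (pow2 m) w (pow2 m′) w′ ⟩
  (pow2 m * pow2 m′) * (w * w′)      ≡⟨ cong (_* (w * w′)) (sym (pow-+ _ m m′)) ⟩
  pow2 (m ℕ.+ m′) * (w * w′)         ∎)

Val≥-*ℤ₍₂₎ : ∀ {m c p q} → Val≥ m c p → ℤ₍₂₎ q → Val≥ m c (p * q)
Val≥-*ℤ₍₂₎ {m} {c} {p} {q} p≥ q∈ =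
  subst₂ (λ a b → Val≥ a b (p * q)) (ℕP.+-identityʳ m) (ℕP.+-identityʳ c) (Val≥-* p≥ (Val≥-ℤ₍₂₎ q∈))

Val≥-sumTo : ∀ n {m c} {f : ℕ → ℚ} → (∀ k → k < n → Val≥ m c (f k)) → Val≥ m c (sumTo n f)
Val≥-sumTo zero f≥ = Val≥-0
Val≥-sumTo (suc n) f≥ = Val≥-+ (Val≥-sumTo n (λ k k<n → f≥ k (ℕP.m<n⇒m<1+n k<n))) (f≥ n (ℕP.n<1+n n))

Val≥-raise : ∀ k {m c q} → Val≥ m c q → Val≥ (k ℕ.+ m) (k ℕ.+ c) q
Val≥-raise k {m} {c} {q} (mkVal≥ w w∈ e) = mkVal≥ w w∈ (begin
  pow2 (k ℕ.+ c) * q             ≡⟨ cong (_* q) (pow-+ _ k c) ⟩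
  (pow2 k * pow2 c) * q          ≡⟨ ℚP.*-assoc (pow2 k) (pow2 c) q ⟩
  pow2 k * (pow2 c * q)          ≡⟨ cong (pow2 k *_) e ⟩
  pow2 k * (pow2 m * w)          ≡⟨ sym (ℚP.*-assoc (pow2 k) (pow2 m) w) ⟩
  (pow2 k * pow2 m) * w          ≡⟨ cong (_* w) (sym (pow-+ _ k m)) ⟩
  pow2 (k ℕ.+ m) * w             ∎)

Val≥-lower : ∀ k {m c q} → Val≥ (k ℕ.+ m) (k ℕ.+ c) q → Val≥ m c q
Val≥-lower k {m} {c} {q} (mkVal≥ w w∈ e) = mkVal≥ w w∈ (*-cancelˡ (pow2 k) (pow2-≢0 k) (begin
  pow2 k * (pow2 c * q)          ≡⟨ sym (ℚP.*-assoc (pow2 k) (pow2 c) q) ⟩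
  (pow2 k * pow2 c) * q          ≡⟨ cong (_* q) (sym (pow-+ _ k c)) ⟩
  pow2 (k ℕ.+ c) * q             ≡⟨ e ⟩
  pow2 (k ℕ.+ m) * w             ≡⟨ cong (_* w) (pow-+ _ k m) ⟩
  (pow2 k * pow2 m) * w          ≡⟨ ℚP.*-assoc (pow2 k) (pow2 m) w ⟩
  pow2 k * (pow2 m * w)          ∎))

Val≥-unscale : ∀ k {m q} → Val≥ m 0 (pow2 k * q) → Val≥ m k q
Val≥-unscale k {m} {q} (mkVal≥ w w∈ e) = mkVal≥ w w∈ (trans (sym (ℚP.*-identityˡ (pow2 k * q))) e)

Val≥-half : ∀ {m q} → Val≥ (suc m) 0 (q + q) → Val≥ m 0 q
Val≥-half {m} {q} q+q≥ = Val≥-lower 1 (Val≥-unscale 1 (subst (Val≥ (suc m) 0) (lemma q) q+q≥))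
  where
  lemma : ∀ q → q + q ≡ ℕ→ℚ 2 * 1ℚ * q
  lemma = solve 1 (λ q → q :+ q := con (ℕ→ℚ 2) :* con 1ℚ :* q) refl

Val≥-weakenᵐ : ∀ {m′ m c q} → m′ ≤ m → Val≥ m c q → Val≥ m′ c q
Val≥-weakenᵐ {m′} {m} {c} {q} m′≤m (mkVal≥ w w∈ e) =
  mkVal≥ (pow2 k * w) (ℤ₍₂₎-* (ℤ₍₂₎-pow2 k) w∈) (begin
    pow2 c * q                 ≡⟨ e ⟩
    pow2 m * w                 ≡⟨ cong (λ i → pow2 i * w) (sym (ℕP.m∸n+n≡m m′≤m)) ⟩
    pow2 (k ℕ.+ m′) * w        ≡⟨ cong (_* w) (trans (pow-+ _ k m′) (ℚP.*-comm (pow2 k) (pow2 m′))) ⟩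
    pow2 m′ * pow2 k * w       ≡⟨ ℚP.*-assoc (pow2 m′) (pow2 k) w ⟩
    pow2 m′ * (pow2 k * w)     ∎)
  where
  k = m ∸ m′

Val≥-weakenᶜ : ∀ {c c′ m q} → c ≤ c′ → Val≥ m c q → Val≥ m c′ q
Val≥-weakenᶜ {c} {c′} c≤c′ q≥ = subst (λ i → Val≥ _ i _) (ℕP.m∸n+n≡m c≤c′)
  (Val≥-weakenᵐ (ℕP.m≤n+m _ (c′ ∸ c)) (Val≥-raise (c′ ∸ c) q≥))

Val≥⇒Val2≥ : ∀ {m q} → Val≥ m 0 q → Val2≥ m q
Val≥⇒Val2≥ {m} {q} (mkVal≥ w (mkℤ₍₂₎ a b b-odd e′) e) = a , b , b-odd , (begin
  q * ℕ→ℚ b                 ≡⟨ cong (_* ℕ→ℚ b) (trans (sym (ℚP.*-identityˡ q)) e) ⟩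
  (pow2 m * w) * ℕ→ℚ b      ≡⟨ ℚP.*-assoc (pow2 m) w (ℕ→ℚ b) ⟩
  pow2 m * (w * ℕ→ℚ b)      ≡⟨ cong (pow2 m *_) e′ ⟩
  pow2 m * ℤ→ℚ a            ≡⟨ ℚP.*-comm (pow2 m) (ℤ→ℚ a) ⟩
  ℤ→ℚ a * pow2 m            ∎)

Val2≥⇒Val≥ : ∀ {m q} → Val2≥ m q → Val≥ m 0 q
Val2≥⇒Val≥ {m} {q} (a , zero , () , _)
Val2≥⇒Val≥ {m} {q} (a , suc b , b-odd , e) =
  mkVal≥ (ℤ→ℚ a * inv B) (ℤ₍₂₎-* (ℤ₍₂₎-ℤ a) (ℤ₍₂₎-inv-odd (suc b) b-odd)) (begin
    1ℚ * q                    ≡⟨ cong (_* q) (sym (*-invʳ B (ℕ→ℚ-suc≢0 b))) ⟩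
    (B * inv B) * q           ≡⟨ ℚ*.xy∙z≈zx∙y B (inv B) q ⟩
    (q * B) * inv B           ≡⟨ cong (_* inv B) e ⟩
    (ℤ→ℚ a * pow2 m) * inv B  ≡⟨ ℚ*.xy∙z≈y∙xz (ℤ→ℚ a) (pow2 m) (inv B) ⟩
    pow2 m * (ℤ→ℚ a * inv B)  ∎)
  where
  B = ℕ→ℚ (suc b)

even⇒≡half*2 : ∀ n → n % 2 ≡ 0 → n ≡ n ℕ./ 2 ℕ.* 2
even⇒≡half*2 n n-even = trans (ℕD.m≡m%n+[m/n]*n n 2) (cong (ℕ._+ n ℕ./ 2 ℕ.* 2) n-even)

odd-factorisation : ∀ n → n ≢ 0 → ∃ λ e → ∃ λ d → d % 2 ≡ 1 × n ≡ 2 ^ e ℕ.* d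
odd-factorisation = <-rec _ step
  where
  step : ∀ n → (∀ {m} → m < n → m ≢ 0 → ∃ λ e → ∃ λ d → d % 2 ≡ 1 × m ≡ 2 ^ e ℕ.* d) →
         n ≢ 0 → ∃ λ e → ∃ λ d → d % 2 ≡ 1 × n ≡ 2 ^ e ℕ.* d
  step n rec n≢0 with n % 2 in n%2 | ℕD.m%n<n n 2
  ... | 1 | _ = 0 , n , n%2 , sym (ℕP.+-identityʳ n)
  ... | suc (suc _) | s≤s (s≤s ())
  ... | 0 | _ with rec (ℕD.m/n<m n 2 {{ℕ.≢-nonZero n≢0}} (s≤s (s≤s z≤n)))
                      (λ half≡0 → n≢0 (trans (even⇒≡half*2 n n%2) (cong (ℕ._* 2) half≡0)))
  ...   | e , d , d-odd , half≡ = suc e , d , d-odd , (begin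
    n                         ≡⟨ even⇒≡half*2 n n%2 ⟩
    n ℕ./ 2 ℕ.* 2             ≡⟨ cong (ℕ._* 2) half≡ ⟩
    2 ^ e ℕ.* d ℕ.* 2         ≡⟨ ℕP.*-comm (2 ^ e ℕ.* d) 2 ⟩
    2 ℕ.* (2 ^ e ℕ.* d)       ≡⟨ sym (ℕP.*-assoc 2 (2 ^ e) d) ⟩
    2 ^ suc e ℕ.* d           ∎)

*-denominator : ∀ q → q * ℕ→ℚ (↧ₙ q) ≡ ℤ→ℚ (↥ q)
*-denominator q@(mkℚ a d-1 _) = ℚP.toℚᵘ-injective (ℚᵘP.≃-trans (ℚP.toℚᵘ-homo-* q (ℕ→ℚ (suc d-1)))
  (ℚᵘP.≃-trans (ℚᵘP.*-cong (ℚᵘP.≃-refl {toℚᵘ q}) (ℤ→ℚ≃mkℚᵘ (ℤ.+ suc d-1)))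
    (ℚᵘP.≃-trans (ℚᵘ.*≡* (ℤP.*-assoc a (ℤ.+ suc d-1) (ℤ.+ 1))) (ℚᵘP.≃-sym (ℤ→ℚ≃mkℚᵘ a)))))

Val≥-exists : ∀ q → ∃ λ e → Val≥ 0 e q
Val≥-exists q@(mkℚ _ _ _) with odd-factorisation (↧ₙ q) (λ ())
... | e , d , d-odd , ↧q≡ = e , mkVal≥ (pow2 e * q) (mkℤ₍₂₎ (↥ q) d d-odd (begin
  pow2 e * q * ℕ→ℚ d      ≡⟨ ℚ*.xy∙z≈y∙xz (pow2 e) q (ℕ→ℚ d) ⟩
  q * (pow2 e * ℕ→ℚ d)    ≡⟨ cong (q *_) (sym (trans (ℕ→ℚ-* (2 ^ e) d) (cong (_* ℕ→ℚ d) (ℕ→ℚ-^ 2 e)))) ⟩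
  q * ℕ→ℚ (2 ^ e ℕ.* d)   ≡⟨ cong (λ z → q * ℕ→ℚ z) (sym ↧q≡) ⟩
  q * ℕ→ℚ (↧ₙ q)          ≡⟨ *-denominator q ⟩
  ℤ→ℚ (↥ q)               ∎)) (sym (ℚP.*-identityˡ (pow2 e * q)))

n<2^n : ∀ n → n < 2 ^ n
n<2^n zero = s≤s z≤n
n<2^n (suc n) = ℕP.<-≤-trans (s≤s (n<2^n n))
  (subst (suc (2 ^ n) ≤_) (cong (2 ^ n ℕ.+_) (sym (ℕP.+-identityʳ (2 ^ n)))) (ℕP.+-monoˡ-≤ (2 ^ n) (ℕP.m^n>0 2 n)))

2^n∣n⇒n≡0 : ∀ n → 2 ^ n ∣ n → n ≡ 0
2^n∣n⇒n≡0 zero _ = refl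
2^n∣n⇒n≡0 (suc n) 2^n∣n = ⊥-elim (ℕP.<⇒≱ (n<2^n (suc n)) (ℕDiv.∣⇒≤ 2^n∣n))

2^m∣*odd⇒2^m∣ : ∀ m x b → b % 2 ≡ 1 → 2 ^ m ∣ x ℕ.* b → 2 ^ m ∣ x
2^m∣*odd⇒2^m∣ zero x b b-odd _ = ℕDiv.1∣ x
2^m∣*odd⇒2^m∣ (suc m) x b b-odd 2^sm∣xb =
  subst (2 ^ suc m ∣_) (sym x≡2x′) (ℕDiv.*-monoʳ-∣ 2 (2^m∣*odd⇒2^m∣ m x′ b b-odd 2^m∣x′b))
  where
  x-even : x % 2 ≡ 0
  x-even = begin
    x % 2                     ≡⟨ sym (ℕD.m%n%n≡m%n x 2) ⟩
    x % 2 % 2                 ≡⟨ cong (_% 2) (sym (ℕP.*-identityʳ (x % 2))) ⟩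
    (x % 2 ℕ.* 1) % 2         ≡⟨ cong (λ z → (x % 2 ℕ.* z) % 2) (sym b-odd) ⟩
    (x % 2 ℕ.* (b % 2)) % 2   ≡⟨ sym (ℕD.%-distribˡ-* x b 2) ⟩
    (x ℕ.* b) % 2             ≡⟨ ℕDiv.n∣m⇒m%n≡0 (x ℕ.* b) 2 (ℕDiv.∣-trans (ℕDiv.m∣m*n (2 ^ m)) 2^sm∣xb) ⟩
    0                         ∎
  2∣x : 2 ∣ x
  2∣x = ℕDiv.m%n≡0⇒n∣m x 2 x-even
  x′ = ℕDiv.quotient 2∣x
  x≡2x′ : x ≡ 2 ℕ.* x′
  x≡2x′ = ℕDiv.m∣n⇒n≡m*quotient 2∣x
  2^m∣x′b : 2 ^ m ∣ x′ ℕ.* b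
  2^m∣x′b = ℕDiv.*-cancelˡ-∣ 2 (subst (2 ^ suc m ∣_) (trans (cong (ℕ._* b) x≡2x′) (ℕP.*-assoc 2 x′ b)) 2^sm∣xb)

Val≥-∀⇒0 : ∀ q → (∀ m → Val≥ m 0 q) → q ≡ 0ℚ
Val≥-∀⇒0 q q≥ with Val≥⇒Val2≥ (q≥ ∣ ↥ q ∣)
... | a , b , b-odd , e = ℚP.↥p≡0⇒p≡0 q (ℤP.∣i∣≡0⇒i≡0 (2^n∣n⇒n≡0 M (2^m∣*odd⇒2^m∣ M M b b-odd 2^M∣Mb)))
  where
  M = ∣ ↥ q ∣
  D = ↧ₙ q
  cleared : ↥ q ℤ.* ℤ.+ b ≡ a ℤ.* ℤ.+ (2 ^ M) ℤ.* ℤ.+ D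
  cleared = ℤ→ℚ-injective (begin
    ℤ→ℚ (↥ q ℤ.* ℤ.+ b)                     ≡⟨ ℤ→ℚ-* (↥ q) (ℤ.+ b) ⟩
    ℤ→ℚ (↥ q) * ℕ→ℚ b                       ≡⟨ cong (_* ℕ→ℚ b) (sym (*-denominator q)) ⟩
    q * ℕ→ℚ D * ℕ→ℚ b                       ≡⟨ ℚ*.xy∙z≈xz∙y q (ℕ→ℚ D) (ℕ→ℚ b) ⟩
    q * ℕ→ℚ b * ℕ→ℚ D                       ≡⟨ cong (_* ℕ→ℚ D) e ⟩
    ℤ→ℚ a * pow2 M * ℕ→ℚ D                  ≡⟨ cong (λ z → ℤ→ℚ a * z * ℕ→ℚ D) (sym (ℕ→ℚ-^ 2 M)) ⟩
    ℤ→ℚ a * ℕ→ℚ (2 ^ M) * ℕ→ℚ D             ≡⟨ sym (cong (_* ℕ→ℚ D) (ℤ→ℚ-* a (ℤ.+ (2 ^ M)))) ⟩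
    ℤ→ℚ (a ℤ.* ℤ.+ (2 ^ M)) * ℕ→ℚ D         ≡⟨ sym (ℤ→ℚ-* (a ℤ.* ℤ.+ (2 ^ M)) (ℤ.+ D)) ⟩
    ℤ→ℚ (a ℤ.* ℤ.+ (2 ^ M) ℤ.* ℤ.+ D)       ∎)
  2^M∣Mb : 2 ^ M ∣ M ℕ.* b
  2^M∣Mb = ℕDiv.divides (∣ a ∣ ℕ.* D) (begin
    M ℕ.* b
      ≡⟨ sym (ℤP.abs-* (↥ q) (ℤ.+ b)) ⟩
    ∣ ↥ q ℤ.* ℤ.+ b ∣
      ≡⟨ cong ∣_∣ cleared ⟩
    ∣ a ℤ.* ℤ.+ (2 ^ M) ℤ.* ℤ.+ D ∣
      ≡⟨ trans (ℤP.abs-* (a ℤ.* ℤ.+ (2 ^ M)) (ℤ.+ D)) (cong (ℕ._* D) (ℤP.abs-* a (ℤ.+ (2 ^ M)))) ⟩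
    ∣ a ∣ ℕ.* 2 ^ M ℕ.* D
      ≡⟨ ℕP.*-assoc ∣ a ∣ (2 ^ M) D ⟩
    ∣ a ∣ ℕ.* (2 ^ M ℕ.* D)
      ≡⟨ cong (∣ a ∣ ℕ.*_) (ℕP.*-comm (2 ^ M) D) ⟩
    ∣ a ∣ ℕ.* (D ℕ.* 2 ^ M)
      ≡⟨ sym (ℕP.*-assoc ∣ a ∣ D (2 ^ M)) ⟩
    ∣ a ∣ ℕ.* D ℕ.* 2 ^ M ∎)

tends0-fromVal≥ : ∀ c {u : ℕ → ℚ} → (∀ N → Val≥ N c (u N)) → Tends0₂ u
tends0-fromVal≥ c {u} u≥ m = m ℕ.+ c , λ N m+c≤N → Val≥⇒Val2≥ (Val≥-lower c
  (subst₂ (λ a b → Val≥ a b (u N)) (ℕP.+-comm m c) (sym (ℕP.+-identityʳ c)) (Val≥-weakenᵐ m+c≤N (u≥ N))))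

tends0-cong : ∀ {u v : ℕ → ℚ} → (∀ N → u N ≡ v N) → Tends0₂ u → Tends0₂ v
tends0-cong u≡v u→0 m with u→0 m
... | N₀ , h = N₀ , λ N N₀≤N → subst (Val2≥ m) (u≡v N) (h N N₀≤N)

tends0-0 : Tends0₂ (λ _ → 0ℚ)
tends0-0 = tends0-fromVal≥ 0 (λ _ → Val≥-0)

tends0-+ : ∀ {u v : ℕ → ℚ} → Tends0₂ u → Tends0₂ v → Tends0₂ (λ N → u N + v N)
tends0-+ {u} {v} u→0 v→0 m with u→0 m | v→0 m
... | N₁ , h₁ | N₂ , h₂ = N₁ ⊔ N₂ , λ N le → Val≥⇒Val2≥ {m} {u N + v N} (Val≥-+
  (Val2≥⇒Val≥ {m} {u N} (h₁ N (ℕP.≤-trans (ℕP.m≤m⊔n N₁ N₂) le)))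
  (Val2≥⇒Val≥ {m} {v N} (h₂ N (ℕP.≤-trans (ℕP.m≤n⊔m N₁ N₂) le))))

tends0-neg : ∀ {u : ℕ → ℚ} → Tends0₂ u → Tends0₂ (λ N → - u N)
tends0-neg {u} u→0 m with u→0 m
... | N₀ , h = N₀ , λ N N₀≤N → Val≥⇒Val2≥ {m} { - u N} (Val≥-neg (Val2≥⇒Val≥ {m} {u N} (h N N₀≤N)))

tends0-- : ∀ {u v : ℕ → ℚ} → Tends0₂ u → Tends0₂ v → Tends0₂ (λ N → u N - v N)
tends0-- {u} {v} u→0 v→0 = tends0-+ {u} {λ N → - v N} u→0 (tends0-neg {v} v→0)

tends0-*ˡ : ∀ c {u : ℕ → ℚ} → Tends0₂ u → Tends0₂ (λ N → c * u N)
tends0-*ˡ c {u} u→0 m with Val≥-exists c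
... | e , c≥ with u→0 (e ℕ.+ m)
...   | N₀ , h = N₀ , λ N N₀≤N →
  Val≥⇒Val2≥ {m} {c * u N} (Val≥-lower e (Val≥-* c≥ (Val2≥⇒Val≥ {e ℕ.+ m} {u N} (h N N₀≤N))))

tends0-sumTo : ∀ n {u : ℕ → ℕ → ℚ} → (∀ k → Tends0₂ (u k)) → Tends0₂ (λ N → sumTo n (λ k → u k N))
tends0-sumTo zero u→0 = tends0-0
tends0-sumTo (suc n) {u} u→0 = tends0-+ {λ N → sumTo n (λ k → u k N)} {u n} (tends0-sumTo n u→0) (u→0 n)

tends0-const⇒0 : ∀ q → Tends0₂ (λ _ → q) → q ≡ 0ℚ
tends0-const⇒0 q q→0 = Val≥-∀⇒0 q (λ m → Val2≥⇒Val≥ {m} {q} (proj₂ (q→0 m) (proj₁ (q→0 m)) ℕP.≤-refl))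

record Bounded (f : ℕ → ℚ) : Set where
  constructor bounded
  field
    bound    : ℕ
    bounded-by : ∀ M → Val≥ 0 bound (f M)

bounded-const : ∀ q → Bounded (λ _ → q)
bounded-const q = bounded (proj₁ (Val≥-exists q)) (λ _ → proj₂ (Val≥-exists q))

bounded-ℤ₍₂₎ : ∀ {f} → (∀ M → ℤ₍₂₎ (f M)) → Bounded f
bounded-ℤ₍₂₎ f∈ = bounded 0 (λ M → Val≥-ℤ₍₂₎ (f∈ M))

bounded-+ : ∀ {f g} → Bounded f → Bounded g → Bounded (λ M → f M + g M)
bounded-+ (bounded c₁ f≥) (bounded c₂ g≥) = bounded (c₁ ⊔ c₂) (λ M →
  Val≥-+ (Val≥-weakenᶜ (ℕP.m≤m⊔n c₁ c₂) (f≥ M)) (Val≥-weakenᶜ (ℕP.m≤n⊔m c₁ c₂) (g≥ M)))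

bounded-- : ∀ {f g} → Bounded f → Bounded g → Bounded (λ M → f M - g M)
bounded-- f-bd (bounded c g≥) = bounded-+ f-bd (bounded c (λ M → Val≥-neg (g≥ M)))

bounded-* : ∀ {f g} → Bounded f → Bounded g → Bounded (λ M → f M * g M)
bounded-* (bounded c₁ f≥) (bounded c₂ g≥) = bounded (c₁ ℕ.+ c₂) (λ M → Val≥-* (f≥ M) (g≥ M))

tends0-*bounded : ∀ {f g : ℕ → ℚ} → (∀ M → Val≥ M 0 (f M)) → Bounded g → Tends0₂ (λ M → f M * g M)
tends0-*bounded {f} {g} f≥ (bounded c g≥) =
  tends0-fromVal≥ c (λ M → subst (λ m → Val≥ m c (f M * g M)) (ℕP.+-identityʳ M) (Val≥-* (f≥ M) (g≥ M)))

evalP-addP : ∀ p q x → evalP (addP p q) x ≡ evalP p x + evalP q x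
evalP-addP [] q x = sym (ℚP.+-identityˡ (evalP q x))
evalP-addP (a ∷ p) [] x = sym (ℚP.+-identityʳ (evalP (a ∷ p) x))
evalP-addP (a ∷ p) (b ∷ q) x =
  trans (cong (λ z → a + b + x * z) (evalP-addP p q x)) (lemma a b x (evalP p x) (evalP q x))
  where
  lemma : ∀ a b x P Q → a + b + x * (P + Q) ≡ a + x * P + (b + x * Q)
  lemma = solve 5 (λ a b x P Q → a :+ b :+ x :* (P :+ Q) := a :+ x :* P :+ (b :+ x :* Q)) refl

evalP-scaleP : ∀ c p x → evalP (scaleP c p) x ≡ c * evalP p x
evalP-scaleP c [] x = sym (ℚP.*-zeroʳ c)
evalP-scaleP c (a ∷ p) x = trans (cong (λ z → c * a + x * z) (evalP-scaleP c p x)) (lemma c a x (evalP p x))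
  where
  lemma : ∀ c a x P → c * a + x * (c * P) ≡ c * (a + x * P)
  lemma = solve 4 (λ c a x P → c :* a :+ x :* (c :* P) := c :* (a :+ x :* P)) refl

evalP-mulP : ∀ p q x → evalP (mulP p q) x ≡ evalP p x * evalP q x
evalP-mulP [] q x = sym (ℚP.*-zeroˡ (evalP q x))
evalP-mulP (a ∷ p) q x = begin
  evalP (addP (scaleP a q) (0ℚ ∷ mulP p q)) x
    ≡⟨ evalP-addP (scaleP a q) (0ℚ ∷ mulP p q) x ⟩
  evalP (scaleP a q) x + (0ℚ + x * evalP (mulP p q) x)
    ≡⟨ cong₂ (λ u v → u + (0ℚ + x * v)) (evalP-scaleP a q x) (evalP-mulP p q x) ⟩
  a * evalP q x + (0ℚ + x * (evalP p x * evalP q x))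
    ≡⟨ lemma a x (evalP p x) (evalP q x) ⟩
  (a + x * evalP p x) * evalP q x ∎
  where
  lemma : ∀ a x P Q → a * Q + (0ℚ + x * (P * Q)) ≡ (a + x * P) * Q
  lemma = solve 4 (λ a x P Q → a :* Q :+ (con 0ℚ :+ x :* (P :* Q)) := (a :+ x :* P) :* Q) refl

evalP-const : ∀ c x → evalP (c ∷ []) x ≡ c
evalP-const c x = solve 2 (λ c x → c :+ x :* con 0ℚ := c) refl c x

evalP-powP : ∀ p m x → evalP (powP p m) x ≡ pow (evalP p x) m
evalP-powP p zero x = evalP-const 1ℚ x
evalP-powP p (suc m) x = trans (evalP-mulP p (powP p m) x) (cong (evalP p x *_) (evalP-powP p m x))

evalP-prodP : ∀ n f x → evalP (prodP n f) x ≡ prodTo n (λ j → evalP (f j) x)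
evalP-prodP zero f x = evalP-const 1ℚ x
evalP-prodP (suc n) f x = trans (evalP-mulP (prodP n f) (f n) x) (cong (_* evalP (f n) x) (evalP-prodP n f x))

evalP-lin : ∀ a x → evalP (lin a) x ≡ x + a
evalP-lin = solve 2 (λ a x → a :+ x :* (con 1ℚ :+ x :* con 0ℚ) := x :+ a) refl

evalP-derivAux-suc : ∀ m p x → evalP (derivAux (suc m) p) x ≡ evalP p x + evalP (derivAux m p) x
evalP-derivAux-suc m [] x = sym (ℚP.+-identityˡ 0ℚ)
evalP-derivAux-suc m (b ∷ p) x = begin
  ℕ→ℚ (suc m) * b + x * evalP (derivAux (suc (suc m)) p) x
    ≡⟨ cong₂ (λ u v → u * b + x * v) (ℕ→ℚ-suc m) (evalP-derivAux-suc (suc m) p x) ⟩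
  (1ℚ + ℕ→ℚ m) * b + x * (evalP p x + evalP (derivAux (suc m) p) x)
    ≡⟨ lemma (ℕ→ℚ m) b x (evalP p x) (evalP (derivAux (suc m) p) x) ⟩
  b + x * evalP p x + (ℕ→ℚ m * b + x * evalP (derivAux (suc m) p) x) ∎
  where
  lemma : ∀ m b x P D → (1ℚ + m) * b + x * (P + D) ≡ b + x * P + (m * b + x * D)
  lemma = solve 5 (λ m b x P D → (con 1ℚ :+ m) :* b :+ x :* (P :+ D) := b :+ x :* P :+ (m :* b :+ x :* D)) refl

evalP-derivAux-zero : ∀ p x → evalP (derivAux 0 p) x ≡ x * evalP (derivP p) x
evalP-derivAux-zero [] x = sym (ℚP.*-zeroʳ x)
evalP-derivAux-zero (b ∷ p) x = solve 3 (λ b x D → con 0ℚ :* b :+ x :* D := x :* D) refl b x (evalP (derivAux 1 p) x)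

evalP-derivP-∷ : ∀ a p x → evalP (derivP (a ∷ p)) x ≡ evalP p x + x * evalP (derivP p) x
evalP-derivP-∷ a p x = trans (evalP-derivAux-suc 0 p x) (cong (evalP p x +_) (evalP-derivAux-zero p x))

taylorRem : Poly → ℚ → ℚ → ℚ
taylorRem [] t h = 0ℚ
taylorRem (a ∷ p) t h = evalP (derivP p) t + (t + h) * taylorRem p t h

taylor : ∀ p t h → evalP p (t + h) ≡ evalP p t + h * evalP (derivP p) t + h * h * taylorRem p t h
taylor [] t h = solve 1 (λ h → con 0ℚ := con 0ℚ :+ h :* con 0ℚ :+ h :* h :* con 0ℚ) refl h
taylor (a ∷ p) t h = begin
  a + (t + h) * evalP p (t + h)
    ≡⟨ cong (λ z → a + (t + h) * z) (taylor p t h) ⟩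
  a + (t + h) * (P + h * D + h * h * T)
    ≡⟨ lemma a t h P D T ⟩
  a + t * P + h * (P + t * D) + h * h * (D + (t + h) * T)
    ≡⟨ cong (λ z → a + t * P + h * z + h * h * (D + (t + h) * T)) (sym (evalP-derivP-∷ a p t)) ⟩
  a + t * P + h * evalP (derivP (a ∷ p)) t + h * h * taylorRem (a ∷ p) t h ∎
  where
  P = evalP p t
  D = evalP (derivP p) t
  T = taylorRem p t h
  lemma : ∀ a t h P D T → a + (t + h) * (P + h * D + h * h * T) ≡ a + t * P + h * (P + t * D) + h * h * (D + (t + h) * T)
  lemma = solve 6 (λ a t h P D T → a :+ (t :+ h) :* (P :+ h :* D :+ h :* h :* T)
                                 := a :+ t :* P :+ h :* (P :+ t :* D) :+ h :* h :* (D :+ (t :+ h) :* T)) refl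

taylorRem-bounded : ∀ p t {h : ℕ → ℚ} → (∀ M → ℤ₍₂₎ (h M)) → Bounded (λ M → taylorRem p t (h M))
taylorRem-bounded [] t h∈ = bounded-const 0ℚ
taylorRem-bounded (a ∷ p) t h∈ = bounded-+ (bounded-const (evalP (derivP p) t))
  (bounded-* (bounded-+ (bounded-const t) (bounded-ℤ₍₂₎ h∈)) (taylorRem-bounded p t h∈))

odd : ℕ → ℕ
odd x = suc (2 ℕ.* x)

odd-%2 : ∀ x → odd x % 2 ≡ 1
odd-%2 x = trans (cong (λ z → suc z % 2) (ℕP.*-comm 2 x)) (ℕD.[m+kn]%n≡m%n 1 x 2)

oddℚ : ℕ → ℚ
oddℚ x = ℕ→ℚ (odd x)

oddℚ-≢0 : ∀ x → oddℚ x ≢ 0ℚ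
oddℚ-≢0 x = ℕ→ℚ-suc≢0 (2 ℕ.* x)

ℤ₍₂₎-inv-oddℚ : ∀ x → ℤ₍₂₎ (inv (oddℚ x))
ℤ₍₂₎-inv-oddℚ x = ℤ₍₂₎-inv-odd (odd x) (odd-%2 x)

oddℚ-+ : ∀ x y → oddℚ (x ℕ.+ y) ≡ oddℚ x + ℕ→ℚ 2 * ℕ→ℚ y
oddℚ-+ x y = begin
  ℕ→ℚ (suc (2 ℕ.* (x ℕ.+ y)))              ≡⟨ cong (λ z → ℕ→ℚ (suc z)) (ℕP.*-distribˡ-+ 2 x y) ⟩
  ℕ→ℚ (odd x ℕ.+ 2 ℕ.* y)                  ≡⟨ ℕ→ℚ-+ (odd x) (2 ℕ.* y) ⟩
  oddℚ x + ℕ→ℚ (2 ℕ.* y)                   ≡⟨ cong (oddℚ x +_) (ℕ→ℚ-* 2 y) ⟩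
  oddℚ x + ℕ→ℚ 2 * ℕ→ℚ y                   ∎

oddℚ-shift : ∀ N x → oddℚ (2 ^ N ℕ.+ x) ≡ oddℚ x + pow2 (suc N)
oddℚ-shift N x = begin
  oddℚ (2 ^ N ℕ.+ x)                  ≡⟨ cong oddℚ (ℕP.+-comm (2 ^ N) x) ⟩
  oddℚ (x ℕ.+ 2 ^ N)                  ≡⟨ oddℚ-+ x (2 ^ N) ⟩
  oddℚ x + ℕ→ℚ 2 * ℕ→ℚ (2 ^ N)        ≡⟨ cong (λ z → oddℚ x + ℕ→ℚ 2 * z) (ℕ→ℚ-^ 2 N) ⟩
  oddℚ x + pow2 (suc N)               ∎

oddℚ-shift-≢0 : ∀ N x → oddℚ x + pow2 (suc N) ≢ 0ℚ
oddℚ-shift-≢0 N x e = oddℚ-≢0 (2 ^ N ℕ.+ x) (trans (oddℚ-shift N x) e)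

ℤ₍₂₎-inv-oddℚ-shift : ∀ N x → ℤ₍₂₎ (inv (oddℚ x + pow2 (suc N)))
ℤ₍₂₎-inv-oddℚ-shift N x = subst (λ z → ℤ₍₂₎ (inv z)) (oddℚ-shift N x) (ℤ₍₂₎-inv-oddℚ (2 ^ N ℕ.+ x))

half-oddℚ : ∀ x → ℕ→ℚ x + ½ ≡ ½ * oddℚ x
half-oddℚ x = begin
  ℕ→ℚ x + ½                       ≡⟨ lemma (ℕ→ℚ x) ⟩
  ½ * (1ℚ + ℕ→ℚ 2 * ℕ→ℚ x)        ≡⟨ cong (λ z → ½ * (1ℚ + z)) (sym (ℕ→ℚ-* 2 x)) ⟩
  ½ * (1ℚ + ℕ→ℚ (2 ℕ.* x))        ≡⟨ cong (½ *_) (sym (ℕ→ℚ-suc (2 ℕ.* x))) ⟩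
  ½ * oddℚ x                      ∎
  where
  lemma : ∀ a → a + ½ ≡ ½ * (1ℚ + ℕ→ℚ 2 * a)
  lemma = solve 1 (λ a → a :+ con ½ := con ½ :* (con 1ℚ :+ con (ℕ→ℚ 2) :* a)) refl

inv-pow-half : ∀ w m → w ≢ 0ℚ → inv (pow (½ * w) m) ≡ pow2 m * pow (inv w) m
inv-pow-half w m w≢0 = begin
  inv (pow (½ * w) m)       ≡⟨ inv-pow (½ * w) m (*-≢0 {½} (λ ()) w≢0) ⟩
  pow (inv (½ * w)) m       ≡⟨ cong (λ z → pow z m) (inv-* ½ w (λ ()) w≢0) ⟩
  pow (ℕ→ℚ 2 * inv w) m     ≡⟨ pow-distrib-* (ℕ→ℚ 2) (inv w) m ⟩
  pow2 m * pow (inv w) m    ∎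

-- Expansion of (u + H)^-(j+1) to first order in H

binomialRem : ℕ → ℚ → ℚ → ℚ
binomialRem zero x h = 0ℚ
binomialRem (suc j) x h = ℕ→ℚ (suc j) * pow x j + (x + h) * binomialRem j x h

ℤ₍₂₎-binomialRem : ∀ j {x h} → ℤ₍₂₎ x → ℤ₍₂₎ h → ℤ₍₂₎ (binomialRem j x h)
ℤ₍₂₎-binomialRem zero x∈ h∈ = ℤ₍₂₎-ℕ 0
ℤ₍₂₎-binomialRem (suc j) x∈ h∈ =
  ℤ₍₂₎-+ (ℤ₍₂₎-* (ℤ₍₂₎-ℕ (suc j)) (ℤ₍₂₎-pow j x∈)) (ℤ₍₂₎-* (ℤ₍₂₎-+ x∈ h∈) (ℤ₍₂₎-binomialRem j x∈ h∈))

binomial : ∀ j x h → pow (x + h) (suc j) ≡ x * pow x j + ℕ→ℚ (suc j) * h * pow x j + h * h * binomialRem j x h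
binomial zero = solve 2 (λ x h → (x :+ h) :* con 1ℚ := x :* con 1ℚ :+ con 1ℚ :* h :* con 1ℚ :+ h :* h :* con 0ℚ) refl
binomial (suc j) x h = begin
  (x + h) * pow (x + h) (suc j)
    ≡⟨ cong ((x + h) *_) (binomial j x h) ⟩
  (x + h) * (x * P + m * h * P + h * h * K)
    ≡⟨ lemma x h P m K ⟩
  x * (x * P) + (1ℚ + m) * h * (x * P) + h * h * (m * P + (x + h) * K)
    ≡⟨ cong (λ z → x * (x * P) + z * h * (x * P) + h * h * (m * P + (x + h) * K)) (sym (ℕ→ℚ-suc (suc j))) ⟩
  x * (x * P) + ℕ→ℚ (suc (suc j)) * h * (x * P) + h * h * (m * P + (x + h) * K) ∎
  where
  m = ℕ→ℚ (suc j)
  P = pow x j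
  K = binomialRem j x h
  lemma : ∀ x h P m K → (x + h) * (x * P + m * h * P + h * h * K)
                      ≡ x * (x * P) + (1ℚ + m) * h * (x * P) + h * h * (m * P + (x + h) * K)
  lemma = solve 5 (λ x h P m K → (x :+ h) :* (x :* P :+ m :* h :* P :+ h :* h :* K)
                               := x :* (x :* P) :+ (con 1ℚ :+ m) :* h :* (x :* P) :+ h :* h :* (m :* P :+ (x :+ h) :* K)) refl

invPowNum : ℕ → ℚ → ℚ → ℚ
invPowNum j u H = m * m * pow u j + m * H * K - u * K
  where
  m = ℕ→ℚ (suc j)
  K = binomialRem j u H

invPowNum-binomial : ∀ j u H → let m = ℕ→ℚ (suc j); Q = pow (u + H) (suc j) in
  H * H * invPowNum j u H ≡ u * u * pow u j - u * Q + m * H * Q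
invPowNum-binomial j u H = begin
  H * H * (m * m * P + m * H * K - u * K)
    ≡⟨ lemma u H m P K ⟩
  u * u * P - u * (u * P + m * H * P + H * H * K) + m * H * (u * P + m * H * P + H * H * K)
    ≡⟨ cong (λ z → u * u * P - u * z + m * H * z) (sym (binomial j u H)) ⟩
  u * u * P - u * pow (u + H) (suc j) + m * H * pow (u + H) (suc j) ∎
  where
  m = ℕ→ℚ (suc j)
  K = binomialRem j u H
  P = pow u j
  lemma : ∀ u H m P K → H * H * (m * m * P + m * H * K - u * K)
                      ≡ u * u * P - u * (u * P + m * H * P + H * H * K) + m * H * (u * P + m * H * P + H * H * K)
  lemma = solve 5 (λ u H m P K → H :* H :* (m :* m :* P :+ m :* H :* K :- u :* K)
    := u :* u :* P :- u :* (u :* P :+ m :* H :* P :+ H :* H :* K) :+ m :* H :* (u :* P :+ m :* H :* P :+ H :* H :* K)) refl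

invPowRem : ℕ → ℚ → ℚ → ℚ
invPowRem j u H = invPowNum j u H * (inv u * (inv u * pow (inv u) j)) * pow (inv (u + H)) (suc j)

ℤ₍₂₎-invPowRem : ∀ j {u H} → ℤ₍₂₎ u → ℤ₍₂₎ H → ℤ₍₂₎ (inv u) → ℤ₍₂₎ (inv (u + H)) → ℤ₍₂₎ (invPowRem j u H)
ℤ₍₂₎-invPowRem j u∈ H∈ u⁻¹∈ v⁻¹∈ =
  ℤ₍₂₎-* (ℤ₍₂₎-* num∈ (ℤ₍₂₎-* u⁻¹∈ (ℤ₍₂₎-* u⁻¹∈ (ℤ₍₂₎-pow j u⁻¹∈)))) (ℤ₍₂₎-pow (suc j) v⁻¹∈)
  where
  m∈ = ℤ₍₂₎-ℕ (suc j)
  K∈ = ℤ₍₂₎-binomialRem j u∈ H∈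
  num∈ = ℤ₍₂₎-- (ℤ₍₂₎-+ (ℤ₍₂₎-* (ℤ₍₂₎-* m∈ m∈) (ℤ₍₂₎-pow j u∈)) (ℤ₍₂₎-* (ℤ₍₂₎-* m∈ H∈) K∈)) (ℤ₍₂₎-* u∈ K∈)

pow-*-pow-inv : ∀ u n → u ≢ 0ℚ → pow u n * pow (inv u) n ≡ 1ℚ
pow-*-pow-inv u n u≢0 = trans (sym (pow-distrib-* u (inv u) n)) (trans (cong (λ z → pow z n) (*-invʳ u u≢0)) (pow-1ℚ n))

invPow-expansion : ∀ j u H → u ≢ 0ℚ → u + H ≢ 0ℚ →
  pow (inv (u + H)) (suc j) - pow (inv u) (suc j) + ℕ→ℚ (suc j) * H * pow (inv u) (suc (suc j)) ≡ H * H * invPowRem j u H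
invPow-expansion j u H u≢0 v≢0 = sym (begin
  H * H * (invPowNum j u H * I * Qi)
    ≡⟨ sym (ℚP.*-assoc (H * H) (invPowNum j u H * I) Qi) ⟩
  H * H * (invPowNum j u H * I) * Qi
    ≡⟨ cong (_* Qi) (sym (ℚP.*-assoc (H * H) (invPowNum j u H) I)) ⟩
  H * H * invPowNum j u H * I * Qi
    ≡⟨ cong (λ z → z * I * Qi) (invPowNum-binomial j u H) ⟩
  (u * u * P - u * Qv + m * H * Qv) * (iu * (iu * Pi)) * Qi
    ≡⟨ lemma₁ u iu P Pi Qv Qi m H ⟩
  (u * iu) * (u * iu) * (P * Pi) * Qi - (u * iu) * (Qv * Qi) * (iu * Pi) + m * H * (Qv * Qi) * (iu * (iu * Pi))
    ≡⟨ cong₂ (λ a b → a * a * b * Qi - a * (Qv * Qi) * (iu * Pi) + m * H * (Qv * Qi) * (iu * (iu * Pi)))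
         (*-invʳ u u≢0) (pow-*-pow-inv u j u≢0) ⟩
  1ℚ * 1ℚ * 1ℚ * Qi - 1ℚ * (Qv * Qi) * (iu * Pi) + m * H * (Qv * Qi) * (iu * (iu * Pi))
    ≡⟨ cong (λ c → 1ℚ * 1ℚ * 1ℚ * Qi - 1ℚ * c * (iu * Pi) + m * H * c * (iu * (iu * Pi)))
         (pow-*-pow-inv (u + H) (suc j) v≢0) ⟩
  1ℚ * 1ℚ * 1ℚ * Qi - 1ℚ * 1ℚ * (iu * Pi) + m * H * 1ℚ * (iu * (iu * Pi))
    ≡⟨ lemma₂ Qi iu Pi m H ⟩
  Qi - iu * Pi + m * H * (iu * (iu * Pi)) ∎)
  where
  m = ℕ→ℚ (suc j)
  P = pow u j
  iu = inv u
  Pi = pow iu j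
  I = iu * (iu * Pi)
  Qv = pow (u + H) (suc j)
  Qi = pow (inv (u + H)) (suc j)
  lemma₁ : ∀ u iu P Pi Qv Qi m H → (u * u * P - u * Qv + m * H * Qv) * (iu * (iu * Pi)) * Qi
         ≡ (u * iu) * (u * iu) * (P * Pi) * Qi - (u * iu) * (Qv * Qi) * (iu * Pi) + m * H * (Qv * Qi) * (iu * (iu * Pi))
  lemma₁ = solve 8 (λ u iu P Pi Qv Qi m H → (u :* u :* P :- u :* Qv :+ m :* H :* Qv) :* (iu :* (iu :* Pi)) :* Qi
    := (u :* iu) :* (u :* iu) :* (P :* Pi) :* Qi :- (u :* iu) :* (Qv :* Qi) :* (iu :* Pi) :+ m :* H :* (Qv :* Qi) :* (iu :* (iu :* Pi))) refl
  lemma₂ : ∀ Qi iu Pi m H → 1ℚ * 1ℚ * 1ℚ * Qi - 1ℚ * 1ℚ * (iu * Pi) + m * H * 1ℚ * (iu * (iu * Pi))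
                          ≡ Qi - iu * Pi + m * H * (iu * (iu * Pi))
  lemma₂ = solve 5 (λ Qi iu Pi m H →
    con 1ℚ :* con 1ℚ :* con 1ℚ :* Qi :- con 1ℚ :* con 1ℚ :* (iu :* Pi) :+ m :* H :* con 1ℚ :* (iu :* (iu :* Pi))
    := Qi :- iu :* Pi :+ m :* H :* (iu :* (iu :* Pi))) refl

oddRem : ℕ → ℕ → ℕ → ℚ
oddRem N j x = invPowRem j (oddℚ x) (pow2 (suc N))

ℤ₍₂₎-oddRem : ∀ N j x → ℤ₍₂₎ (oddRem N j x)
ℤ₍₂₎-oddRem N j x = ℤ₍₂₎-invPowRem j (ℤ₍₂₎-ℕ (odd x)) (ℤ₍₂₎-pow2 (suc N)) (ℤ₍₂₎-inv-oddℚ x) (ℤ₍₂₎-inv-oddℚ-shift N x)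

derivRem : (ℚ → ℚ) → ℚ → ℚ → ℕ → ℚ
derivRem F t F′ M = inv (pow2 M) * (F (t + pow2 M) - F t - pow2 M * F′)

record HasDeriv₂ (F : ℚ → ℚ) (t F′ : ℚ) : Set where
  constructor hasDeriv₂
  field
    derivRem→0 : Tends0₂ (derivRem F t F′)

hasDeriv₂-unique : ∀ {F G : ℚ → ℚ} {t a b} → F t ≡ G t → (∀ M → F (t + pow2 M) ≡ G (t + pow2 M)) →
  HasDeriv₂ F t a → HasDeriv₂ G t b → a ≡ b
hasDeriv₂-unique {F} {G} {t} {a} {b} Ft≡Gt F≡G (hasDeriv₂ F′a) (hasDeriv₂ G′b) = begin
  a
    ≡⟨ lemma₁ a b ⟩
  b - (b - a)
    ≡⟨ cong (λ z → b - z) (tends0-const⇒0 (b - a)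
         (tends0-cong difference (tends0-- {derivRem F t a} {derivRem G t b} F′a G′b))) ⟩
  b - 0ℚ
    ≡⟨ lemma₂ b ⟩
  b ∎
  where
  difference : ∀ M → derivRem F t a M - derivRem G t b M ≡ b - a
  difference M = begin
    i * (F (t + h) - F t - h * a) - i * (G (t + h) - G t - h * b)
      ≡⟨ cong₂ (λ x y → i * (x - y - h * a) - i * (G (t + h) - G t - h * b)) (F≡G M) Ft≡Gt ⟩
    i * (G (t + h) - G t - h * a) - i * (G (t + h) - G t - h * b)
      ≡⟨ lemma₃ i h (G (t + h)) (G t) a b ⟩
    i * (h * (b - a))
      ≡⟨ inv-pow2-*-cancel M (b - a) ⟩
    b - a ∎
    where
    h = pow2 M
    i = inv h
    lemma₃ : ∀ i h X Y a b → i * (X - Y - h * a) - i * (X - Y - h * b) ≡ i * (h * (b - a))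
    lemma₃ = solve 6 (λ i h X Y a b → i :* (X :- Y :- h :* a) :- i :* (X :- Y :- h :* b) := i :* (h :* (b :- a))) refl
  lemma₁ : ∀ a b → a ≡ b - (b - a)
  lemma₁ = solve 2 (λ a b → a := b :- (b :- a)) refl
  lemma₂ : ∀ b → b - 0ℚ ≡ b
  lemma₂ = solve 1 (λ b → b :- con 0ℚ := b) refl

hasDeriv₂-*ˡ : ∀ c {F : ℚ → ℚ} {t F′} → HasDeriv₂ F t F′ → HasDeriv₂ (λ y → c * F y) t (c * F′)
hasDeriv₂-*ˡ c {F} {t} {F′} (hasDeriv₂ F′-deriv) = hasDeriv₂
  (tends0-cong (λ M → lemma c (inv (pow2 M)) (pow2 M) (F (t + pow2 M)) (F t) F′) (tends0-*ˡ c F′-deriv))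
  where
  lemma : ∀ c i h X Y D → c * (i * (X - Y - h * D)) ≡ i * (c * X - c * Y - h * (c * D))
  lemma = solve 6 (λ c i h X Y D → c :* (i :* (X :- Y :- h :* D)) := i :* (c :* X :- c :* Y :- h :* (c :* D))) refl

hasDeriv₂-sumTo : ∀ n {F : ℕ → ℚ → ℚ} {t} {F′ : ℕ → ℚ} → (∀ k → HasDeriv₂ (F k) t (F′ k)) →
  HasDeriv₂ (λ y → sumTo n (λ k → F k y)) t (sumTo n F′)
hasDeriv₂-sumTo n {F} {t} {F′} F′-deriv = hasDeriv₂
  (tends0-cong (λ M → sumTo-remainder n (inv (pow2 M)) (pow2 M)) (tends0-sumTo n (λ k → HasDeriv₂.derivRem→0 (F′-deriv k))))
  where
  sumTo-remainder : ∀ n i h → sumTo n (λ k → i * (F k (t + h) - F k t - h * F′ k))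
                            ≡ i * (sumTo n (λ k → F k (t + h)) - sumTo n (λ k → F k t) - h * sumTo n F′)
  sumTo-remainder zero i h = solve 2 (λ i h → con 0ℚ := i :* (con 0ℚ :- con 0ℚ :- h :* con 0ℚ)) refl i h
  sumTo-remainder (suc n) i h =
    trans (cong (_+ i * (F n (t + h) - F n t - h * F′ n)) (sumTo-remainder n i h))
          (lemma i h (sumTo n (λ k → F k (t + h))) (sumTo n (λ k → F k t)) (sumTo n F′) (F n (t + h)) (F n t) (F′ n))
    where
    lemma : ∀ i h A B C a b c → i * (A - B - h * C) + i * (a - b - h * c) ≡ i * (A + a - (B + b) - h * (C + c))
    lemma = solve 8 (λ i h A B C a b c → i :* (A :- B :- h :* C) :+ i :* (a :- b :- h :* c)
                                       := i :* (A :+ a :- (B :+ b) :- h :* (C :+ c))) refl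

hasDeriv₂-translate : ∀ a {F : ℚ → ℚ} {t F′} → HasDeriv₂ F (t + a) F′ → HasDeriv₂ (λ y → F (y + a)) t F′
hasDeriv₂-translate a {F} {t} {F′} (hasDeriv₂ F′-deriv) = hasDeriv₂ (tends0-cong (λ M →
  cong (λ z → inv (pow2 M) * (F z - F (t + a) - pow2 M * F′)) (ℚ+.xy∙z≈xz∙y t a (pow2 M))) F′-deriv)

-- At p = ½ u with u odd, p + 2^M = ½ (u + 2^{M+1}) has a 2-integral inverse up to the factor 2.
derivRem-invPow-halfOdd : ∀ j w M → let p = ½ * oddℚ w in
  derivRem (λ y → inv (pow y (suc j))) p (- (ℕ→ℚ (suc j) * inv (pow p (suc (suc j))))) M
  ≡ pow2 M * (pow2 (suc j) * ℕ→ℚ 4 * oddRem M j w)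
derivRem-invPow-halfOdd j w M = begin
  i * (inv (pow (½ * u + h) (suc j)) - inv (pow (½ * u) (suc j)) - h * - (m * inv (pow (½ * u) (suc (suc j)))))
    ≡⟨ cong (λ z → i * (inv (pow z (suc j)) - inv (pow (½ * u) (suc j)) - h * - (m * inv (pow (½ * u) (suc (suc j))))))
         (lemma₁ u h) ⟩
  i * (inv (pow (½ * (u + H)) (suc j)) - inv (pow (½ * u) (suc j)) - h * - (m * inv (pow (½ * u) (suc (suc j)))))
    ≡⟨ cong₂ (λ x y → i * (x - y - h * - (m * inv (pow (½ * u) (suc (suc j))))))
         (inv-pow-half (u + H) (suc j) (oddℚ-shift-≢0 M w)) (inv-pow-half u (suc j) (oddℚ-≢0 w)) ⟩
  i * (c * A - c * B - h * - (m * inv (pow (½ * u) (suc (suc j)))))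
    ≡⟨ cong (λ z → i * (c * A - c * B - h * - (m * z))) (inv-pow-half u (suc (suc j)) (oddℚ-≢0 w)) ⟩
  i * (c * A - c * B - h * - (m * (ℕ→ℚ 2 * c * C)))
    ≡⟨ lemma₂ i h c A B C m ⟩
  c * i * (A - B + m * H * C)
    ≡⟨ cong (c * i *_) (invPow-expansion j u H (oddℚ-≢0 w) (oddℚ-shift-≢0 M w)) ⟩
  c * i * (H * H * oddRem M j w)
    ≡⟨ lemma₃ c i h (oddRem M j w) ⟩
  i * (h * (h * (c * ℕ→ℚ 4 * oddRem M j w)))
    ≡⟨ inv-pow2-*-cancel M (h * (c * ℕ→ℚ 4 * oddRem M j w)) ⟩
  h * (c * ℕ→ℚ 4 * oddRem M j w) ∎
  where
  u = oddℚ w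
  m = ℕ→ℚ (suc j)
  h = pow2 M
  i = inv h
  H = pow2 (suc M)
  c = pow2 (suc j)
  A = pow (inv (u + H)) (suc j)
  B = pow (inv u) (suc j)
  C = pow (inv u) (suc (suc j))
  lemma₁ : ∀ u h → ½ * u + h ≡ ½ * (u + ℕ→ℚ 2 * h)
  lemma₁ = solve 2 (λ u h → con ½ :* u :+ h := con ½ :* (u :+ con (ℕ→ℚ 2) :* h)) refl
  lemma₂ : ∀ i h c A B C m → i * (c * A - c * B - h * - (m * (ℕ→ℚ 2 * c * C))) ≡ c * i * (A - B + m * (ℕ→ℚ 2 * h) * C)
  lemma₂ = solve 7 (λ i h c A B C m → i :* (c :* A :- c :* B :- h :* :- (m :* (con (ℕ→ℚ 2) :* c :* C)))
                                    := c :* i :* (A :- B :+ m :* (con (ℕ→ℚ 2) :* h) :* C)) refl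
  lemma₃ : ∀ c i h W → c * i * ((ℕ→ℚ 2 * h) * (ℕ→ℚ 2 * h) * W) ≡ i * (h * (h * (c * ℕ→ℚ 4 * W)))
  lemma₃ = solve 4 (λ c i h W → c :* i :* ((con (ℕ→ℚ 2) :* h) :* (con (ℕ→ℚ 2) :* h) :* W)
                              := i :* (h :* (h :* (c :* con (ℕ→ℚ 4) :* W)))) refl

hasDeriv₂-invPow-halfOdd : ∀ j w → let p = ½ * oddℚ w in
  HasDeriv₂ (λ y → inv (pow y (suc j))) p (- (ℕ→ℚ (suc j) * inv (pow p (suc (suc j)))))
hasDeriv₂-invPow-halfOdd j w = hasDeriv₂ (tends0-fromVal≥ 0 (λ M →
  subst (Val≥ M 0) (sym (derivRem-invPow-halfOdd j w M))
    (Val≥-*ℤ₍₂₎ (Val≥-pow2 M) (ℤ₍₂₎-* (ℤ₍₂₎-* (ℤ₍₂₎-pow2 (suc j)) (ℤ₍₂₎-ℕ 4)) (ℤ₍₂₎-oddRem M j w)))))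

quotientRem : ℚ → ℚ → ℚ → ℚ → ℚ → ℚ → ℚ → ℚ
quotientRem p₀ p₁ ρp q₀ q₁ ρq h =
  ρp * q₀ * q₀ - p₀ * q₀ * ρq - p₁ * q₀ * q₁ + p₀ * q₁ * q₁ + h * (p₀ * q₁ * ρq - p₁ * q₀ * ρq)

quotient-expansion : ∀ {P₁ Q₁} p₀ p₁ ρp q₀ q₁ ρq h →
  P₁ ≡ p₀ + h * p₁ + h * h * ρp → Q₁ ≡ q₀ + h * q₁ + h * h * ρq → q₀ ≢ 0ℚ → Q₁ ≢ 0ℚ →
  P₁ * inv Q₁ - p₀ * inv q₀ - h * ((p₁ * q₀ - p₀ * q₁) * inv (pow q₀ 2))
    ≡ h * h * (quotientRem p₀ p₁ ρp q₀ q₁ ρq h * (inv Q₁ * (inv q₀ * inv q₀)))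
quotient-expansion {P₁} {Q₁} p₀ p₁ ρp q₀ q₁ ρq h P₁≡ Q₁≡ q₀≢0 Q₁≢0 = sym (begin
  h * h * (quotientRem p₀ p₁ ρp q₀ q₁ ρq h * Z)
    ≡⟨ lemma₁ h p₀ p₁ ρp q₀ q₁ ρq Z ⟩
  ((p₀ + h * p₁ + h * h * ρp) * q₀ * q₀ - p₀ * q₀ * (q₀ + h * q₁ + h * h * ρq)
     - h * D * (q₀ + h * q₁ + h * h * ρq)) * Z
    ≡⟨ cong₂ (λ a b → (a * q₀ * q₀ - p₀ * q₀ * b - h * D * b) * Z) (sym P₁≡) (sym Q₁≡) ⟩
  (P₁ * q₀ * q₀ - p₀ * q₀ * Q₁ - h * D * Q₁) * (inv Q₁ * (inv q₀ * inv q₀))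
    ≡⟨ lemma₂ P₁ p₀ q₀ Q₁ (inv Q₁) (inv q₀) h D ⟩
  P₁ * inv Q₁ * (q₀ * inv q₀) * (q₀ * inv q₀) - p₀ * inv q₀ * (q₀ * inv q₀) * (Q₁ * inv Q₁)
    - h * (D * pow (inv q₀) 2) * (Q₁ * inv Q₁)
    ≡⟨ cong₂ (λ a b → P₁ * inv Q₁ * a * a - p₀ * inv q₀ * a * b - h * (D * pow (inv q₀) 2) * b)
         (*-invʳ q₀ q₀≢0) (*-invʳ Q₁ Q₁≢0) ⟩
  P₁ * inv Q₁ * 1ℚ * 1ℚ - p₀ * inv q₀ * 1ℚ * 1ℚ - h * (D * pow (inv q₀) 2) * 1ℚ
    ≡⟨ lemma₃ (P₁ * inv Q₁) (p₀ * inv q₀) h (D * pow (inv q₀) 2) ⟩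
  P₁ * inv Q₁ - p₀ * inv q₀ - h * (D * pow (inv q₀) 2)
    ≡⟨ cong (λ z → P₁ * inv Q₁ - p₀ * inv q₀ - h * (D * z)) (sym (inv-pow q₀ 2 q₀≢0)) ⟩
  P₁ * inv Q₁ - p₀ * inv q₀ - h * (D * inv (pow q₀ 2)) ∎)
  where
  D = p₁ * q₀ - p₀ * q₁
  Z = inv Q₁ * (inv q₀ * inv q₀)
  lemma₁ : ∀ h p₀ p₁ ρp q₀ q₁ ρq Z → h * h * (quotientRem p₀ p₁ ρp q₀ q₁ ρq h * Z)
         ≡ ((p₀ + h * p₁ + h * h * ρp) * q₀ * q₀ - p₀ * q₀ * (q₀ + h * q₁ + h * h * ρq)
            - h * (p₁ * q₀ - p₀ * q₁) * (q₀ + h * q₁ + h * h * ρq)) * Z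
  lemma₁ = solve 8 (λ h p₀ p₁ ρp q₀ q₁ ρq Z →
    h :* h :* ((ρp :* q₀ :* q₀ :- p₀ :* q₀ :* ρq :- p₁ :* q₀ :* q₁ :+ p₀ :* q₁ :* q₁ :+ h :* (p₀ :* q₁ :* ρq :- p₁ :* q₀ :* ρq)) :* Z)
    := ((p₀ :+ h :* p₁ :+ h :* h :* ρp) :* q₀ :* q₀ :- p₀ :* q₀ :* (q₀ :+ h :* q₁ :+ h :* h :* ρq)
        :- h :* (p₁ :* q₀ :- p₀ :* q₁) :* (q₀ :+ h :* q₁ :+ h :* h :* ρq)) :* Z) refl
  lemma₂ : ∀ P₁ p₀ q₀ Q₁ iQ₁ iq₀ h D → (P₁ * q₀ * q₀ - p₀ * q₀ * Q₁ - h * D * Q₁) * (iQ₁ * (iq₀ * iq₀))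
         ≡ P₁ * iQ₁ * (q₀ * iq₀) * (q₀ * iq₀) - p₀ * iq₀ * (q₀ * iq₀) * (Q₁ * iQ₁) - h * (D * (iq₀ * (iq₀ * 1ℚ))) * (Q₁ * iQ₁)
  lemma₂ = solve 8 (λ P₁ p₀ q₀ Q₁ iQ₁ iq₀ h D → (P₁ :* q₀ :* q₀ :- p₀ :* q₀ :* Q₁ :- h :* D :* Q₁) :* (iQ₁ :* (iq₀ :* iq₀))
    := P₁ :* iQ₁ :* (q₀ :* iq₀) :* (q₀ :* iq₀) :- p₀ :* iq₀ :* (q₀ :* iq₀) :* (Q₁ :* iQ₁)
       :- h :* (D :* (iq₀ :* (iq₀ :* con 1ℚ))) :* (Q₁ :* iQ₁)) refl
  lemma₃ : ∀ a b h c → a * 1ℚ * 1ℚ - b * 1ℚ * 1ℚ - h * c * 1ℚ ≡ a - b - h * c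
  lemma₃ = solve 4 (λ a b h c → a :* con 1ℚ :* con 1ℚ :- b :* con 1ℚ :* con 1ℚ :- h :* c :* con 1ℚ := a :- b :- h :* c) refl

bounded-quotientRem : ∀ p₀ p₁ q₀ q₁ {ρp ρq : ℕ → ℚ} → Bounded ρp → Bounded ρq →
  Bounded (λ M → quotientRem p₀ p₁ (ρp M) q₀ q₁ (ρq M) (pow2 M))
bounded-quotientRem p₀ p₁ q₀ q₁ ρp-bd ρq-bd =
  bounded-+ (bounded-+ (bounded-- (bounded-- (bounded-* (bounded-* ρp-bd (c q₀)) (c q₀)) (bounded-* (c (p₀ * q₀)) ρq-bd))
                                  (c (p₁ * q₀ * q₁)))
                       (c (p₀ * q₁ * q₁)))
            (bounded-* (bounded-ℤ₍₂₎ ℤ₍₂₎-pow2)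
                       (bounded-- (bounded-* (c (p₀ * q₁)) ρq-bd) (bounded-* (c (p₁ * q₀)) ρq-bd)))
  where
  c = bounded-const

hasDeriv₂-polyQuotient : ∀ P Q t → evalP Q t ≢ 0ℚ → (∀ M → evalP Q (t + pow2 M) ≢ 0ℚ) →
  Bounded (λ M → inv (evalP Q (t + pow2 M))) →
  HasDeriv₂ (λ y → evalP P y * inv (evalP Q y)) t
            ((evalP (derivP P) t * evalP Q t - evalP P t * evalP (derivP Q) t) * inv (pow (evalP Q t) 2))
hasDeriv₂-polyQuotient P Q t q₀≢0 Q₁≢0 Q₁⁻¹-bounded =
  hasDeriv₂ (tends0-cong (λ M → sym (remainder M)) (tends0-*bounded Val≥-pow2 Y-bounded))
  where
  p₀ = evalP P t
  p₁ = evalP (derivP P) t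
  q₀ = evalP Q t
  q₁ = evalP (derivP Q) t
  ρP ρQ Y : ℕ → ℚ
  ρP M = taylorRem P t (pow2 M)
  ρQ M = taylorRem Q t (pow2 M)
  Y M = quotientRem p₀ p₁ (ρP M) q₀ q₁ (ρQ M) (pow2 M) * (inv (evalP Q (t + pow2 M)) * (inv q₀ * inv q₀))
  Y-bounded : Bounded Y
  Y-bounded = bounded-* (bounded-quotientRem p₀ p₁ q₀ q₁ (taylorRem-bounded P t ℤ₍₂₎-pow2)
                                                         (taylorRem-bounded Q t ℤ₍₂₎-pow2))
                        (bounded-* Q₁⁻¹-bounded (bounded-const (inv q₀ * inv q₀)))
  remainder : ∀ M → derivRem (λ y → evalP P y * inv (evalP Q y)) t ((p₁ * q₀ - p₀ * q₁) * inv (pow q₀ 2)) M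
                  ≡ pow2 M * Y M
  remainder M = begin
    i * (evalP P (t + h) * inv (evalP Q (t + h)) - p₀ * inv q₀ - h * ((p₁ * q₀ - p₀ * q₁) * inv (pow q₀ 2)))
      ≡⟨ cong (i *_) (quotient-expansion p₀ p₁ (ρP M) q₀ q₁ (ρQ M) h (taylor P t h) (taylor Q t h) q₀≢0 (Q₁≢0 M)) ⟩
    i * (h * h * Y M)      ≡⟨ cong (i *_) (ℚP.*-assoc h h (Y M)) ⟩
    i * (h * (h * Y M))    ≡⟨ inv-pow2-*-cancel M (h * Y M) ⟩
    h * Y M                ∎
    where
    h = pow2 M
    i = inv h

evalP-numR : ∀ n y → evalP (numR n) y ≡ pow2 (8 ℕ.* n) * ((ℕ→ℚ n + ℕ→ℚ 2 * y) * pow (prodTo n (λ j → y + (½ + ℕ→ℚ j))) 4)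
evalP-numR n y = begin
  evalP (numR n) y
    ≡⟨ evalP-scaleP (pow2 (8 ℕ.* n)) (mulP (ℕ→ℚ n ∷ ℕ→ℚ 2 ∷ []) (powP A 4)) y ⟩
  pow2 (8 ℕ.* n) * evalP (mulP (ℕ→ℚ n ∷ ℕ→ℚ 2 ∷ []) (powP A 4)) y
    ≡⟨ cong (pow2 (8 ℕ.* n) *_) (evalP-mulP (ℕ→ℚ n ∷ ℕ→ℚ 2 ∷ []) (powP A 4) y) ⟩
  pow2 (8 ℕ.* n) * (evalP (ℕ→ℚ n ∷ ℕ→ℚ 2 ∷ []) y * evalP (powP A 4) y)
    ≡⟨ cong₂ (λ a b → pow2 (8 ℕ.* n) * (a * b)) (lemma (ℕ→ℚ n) y)
         (trans (evalP-powP A 4 y) (cong (λ z → pow z 4)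
           (trans (evalP-prodP n (λ j → lin (½ + ℕ→ℚ j)) y) (prodTo-cong n (λ j → evalP-lin (½ + ℕ→ℚ j) y))))) ⟩
  pow2 (8 ℕ.* n) * ((ℕ→ℚ n + ℕ→ℚ 2 * y) * pow (prodTo n (λ j → y + (½ + ℕ→ℚ j))) 4) ∎
  where
  A = prodP n (λ j → lin (½ + ℕ→ℚ j))
  lemma : ∀ a y → a + y * (ℕ→ℚ 2 + y * 0ℚ) ≡ a + ℕ→ℚ 2 * y
  lemma = solve 2 (λ a y → a :+ y :* (con (ℕ→ℚ 2) :+ y :* con 0ℚ) := a :+ con (ℕ→ℚ 2) :* y) refl

evalP-denR : ∀ n y → evalP (denR n) y ≡ pow (prodTo (suc n) (λ j → y + ℕ→ℚ j)) 4
evalP-denR n y = trans (evalP-powP (prodP (suc n) (λ j → lin (ℕ→ℚ j))) 4 y) (cong (λ z → pow z 4)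
  (trans (evalP-prodP (suc n) (λ j → lin (ℕ→ℚ j)) y) (prodTo-cong (suc n) (λ j → evalP-lin (ℕ→ℚ j) y))))

evalP-denR-≢0 : ∀ n y → (∀ j → j < suc n → y + ℕ→ℚ j ≢ 0ℚ) → evalP (denR n) y ≢ 0ℚ
evalP-denR-≢0 n y y+j≢0 den≡0 =
  pow-≢0 4 (prodTo-≢0 (suc n) (λ j → y + ℕ→ℚ j) y+j≢0) (trans (sym (evalP-denR n y)) den≡0)

partialFraction : ℕ → (ℕ → ℕ → ℚ) → ℚ → ℚ
partialFraction n r y = sumTo 4 (λ i′ → sumTo (suc n) (λ k → r (suc i′) k * inv (pow (y + ℕ→ℚ k) (suc i′))))

partialFraction′ : ℕ → (ℕ → ℕ → ℚ) → ℚ → ℚ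
partialFraction′ n r y =
  - sumTo 4 (λ i′ → sumTo (suc n) (λ k → ℕ→ℚ (suc i′) * r (suc i′) k * inv (pow (y + ℕ→ℚ k) (suc (suc i′)))))

halfInteger-+ : ∀ x k → ℕ→ℚ x + ½ + ℕ→ℚ k ≡ ½ * oddℚ (x ℕ.+ k)
halfInteger-+ x k = begin
  ℕ→ℚ x + ½ + ℕ→ℚ k      ≡⟨ ℚ+.xy∙z≈xz∙y (ℕ→ℚ x) ½ (ℕ→ℚ k) ⟩
  ℕ→ℚ x + ℕ→ℚ k + ½      ≡⟨ cong (_+ ½) (sym (ℕ→ℚ-+ x k)) ⟩
  ℕ→ℚ (x ℕ.+ k) + ½      ≡⟨ half-oddℚ (x ℕ.+ k) ⟩
  ½ * oddℚ (x ℕ.+ k)     ∎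

halfInteger-+pow2 : ∀ x k M → ℕ→ℚ x + ½ + pow2 M + ℕ→ℚ k ≡ ½ * (oddℚ (x ℕ.+ k) + pow2 (suc M))
halfInteger-+pow2 x k M = begin
  ℕ→ℚ x + ½ + pow2 M + ℕ→ℚ k                 ≡⟨ lemma (ℕ→ℚ x + ½) (pow2 M) (ℕ→ℚ k) ⟩
  ℕ→ℚ x + ½ + ℕ→ℚ k + ½ * pow2 (suc M)       ≡⟨ cong (_+ ½ * pow2 (suc M)) (halfInteger-+ x k) ⟩
  ½ * oddℚ (x ℕ.+ k) + ½ * pow2 (suc M)       ≡⟨ sym (ℚP.*-distribˡ-+ ½ (oddℚ (x ℕ.+ k)) (pow2 (suc M))) ⟩
  ½ * (oddℚ (x ℕ.+ k) + pow2 (suc M))         ∎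
  where
  lemma : ∀ a h b → a + h + b ≡ a + b + ½ * (ℕ→ℚ 2 * h)
  lemma = solve 3 (λ a h b → a :+ h :+ b := a :+ b :+ con ½ :* (con (ℕ→ℚ 2) :* h)) refl

halfInteger-+-≢0 : ∀ x k → ℕ→ℚ x + ½ + ℕ→ℚ k ≢ 0ℚ
halfInteger-+-≢0 x k e = *-≢0 {½} (λ ()) (oddℚ-≢0 (x ℕ.+ k)) (trans (sym (halfInteger-+ x k)) e)

halfInteger-+pow2-≢0 : ∀ x k M → ℕ→ℚ x + ½ + pow2 M + ℕ→ℚ k ≢ 0ℚ
halfInteger-+pow2-≢0 x k M e =
  *-≢0 {½} (λ ()) (oddℚ-shift-≢0 M (x ℕ.+ k)) (trans (sym (halfInteger-+pow2 x k M)) e)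

ℤ₍₂₎-inv-halfInteger-+pow2 : ∀ x k M → ℤ₍₂₎ (inv (ℕ→ℚ x + ½ + pow2 M + ℕ→ℚ k))
ℤ₍₂₎-inv-halfInteger-+pow2 x k M = subst ℤ₍₂₎ (sym inv≡) (ℤ₍₂₎-* (ℤ₍₂₎-ℕ 2) (ℤ₍₂₎-inv-oddℚ-shift M (x ℕ.+ k)))
  where
  inv≡ : inv (ℕ→ℚ x + ½ + pow2 M + ℕ→ℚ k) ≡ ℕ→ℚ 2 * inv (oddℚ (x ℕ.+ k) + pow2 (suc M))
  inv≡ = trans (cong inv (halfInteger-+pow2 x k M)) (inv-* ½ _ (λ ()) (oddℚ-shift-≢0 M (x ℕ.+ k)))

hasDeriv₂-Rn : ∀ n x → HasDeriv₂ (Rn n) (ℕ→ℚ x + ½) (Rn′ n (ℕ→ℚ x + ½))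
hasDeriv₂-Rn n x = hasDeriv₂-polyQuotient (numR n) (denR n) t
  (evalP-denR-≢0 n t (λ j _ → halfInteger-+-≢0 x j))
  (λ M → evalP-denR-≢0 n (t + pow2 M) (λ j _ → halfInteger-+pow2-≢0 x j M))
  (bounded-ℤ₍₂₎ inv-den∈)
  where
  t = ℕ→ℚ x + ½
  inv-den∈ : ∀ M → ℤ₍₂₎ (inv (evalP (denR n) (t + pow2 M)))
  inv-den∈ M = subst ℤ₍₂₎ (sym inv-den≡) (ℤ₍₂₎-pow 4 (ℤ₍₂₎-prodTo (suc n) (λ j → ℤ₍₂₎-inv-halfInteger-+pow2 x j M)))
    where
    t+h+j≢0 : ∀ j → j < suc n → t + pow2 M + ℕ→ℚ j ≢ 0ℚ
    t+h+j≢0 j _ = halfInteger-+pow2-≢0 x j M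
    inv-den≡ : inv (evalP (denR n) (t + pow2 M)) ≡ pow (prodTo (suc n) (λ j → inv (t + pow2 M + ℕ→ℚ j))) 4
    inv-den≡ = begin
      inv (evalP (denR n) (t + pow2 M))                           ≡⟨ cong inv (evalP-denR n (t + pow2 M)) ⟩
      inv (pow (prodTo (suc n) (λ j → t + pow2 M + ℕ→ℚ j)) 4)     ≡⟨ inv-pow _ 4 (prodTo-≢0 (suc n) _ t+h+j≢0) ⟩
      pow (inv (prodTo (suc n) (λ j → t + pow2 M + ℕ→ℚ j))) 4     ≡⟨ cong (λ z → pow z 4) (inv-prodTo (suc n) _ t+h+j≢0) ⟩
      pow (prodTo (suc n) (λ j → inv (t + pow2 M + ℕ→ℚ j))) 4     ∎

hasDeriv₂-partialFraction : ∀ n r x → HasDeriv₂ (partialFraction n r) (ℕ→ℚ x + ½) (partialFraction′ n r (ℕ→ℚ x + ½))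
hasDeriv₂-partialFraction n r x = subst (HasDeriv₂ (partialFraction n r) t) derivative≡
  (hasDeriv₂-sumTo 4 (λ i′ → hasDeriv₂-sumTo (suc n) (λ k →
    hasDeriv₂-*ˡ (r (suc i′) k) (hasDeriv₂-translate (ℕ→ℚ k) (invPow-deriv i′ k)))))
  where
  t = ℕ→ℚ x + ½
  invPow-deriv : ∀ i′ k → HasDeriv₂ (λ y → inv (pow y (suc i′))) (t + ℕ→ℚ k)
                                    (- (ℕ→ℚ (suc i′) * inv (pow (t + ℕ→ℚ k) (suc (suc i′)))))
  invPow-deriv i′ k = subst (λ p → HasDeriv₂ (λ y → inv (pow y (suc i′))) p (- (ℕ→ℚ (suc i′) * inv (pow p (suc (suc i′))))))
    (sym (halfInteger-+ x k)) (hasDeriv₂-invPow-halfOdd i′ (x ℕ.+ k))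
  derivative≡ : sumTo 4 (λ i′ → sumTo (suc n) (λ k → r (suc i′) k * - (ℕ→ℚ (suc i′) * inv (pow (t + ℕ→ℚ k) (suc (suc i′))))))
              ≡ partialFraction′ n r t
  derivative≡ = trans (sumTo-cong 4 (λ i′ → trans (sumTo-cong (suc n) (λ k → lemma (r (suc i′) k) (ℕ→ℚ (suc i′)) (inv (pow (t + ℕ→ℚ k) (suc (suc i′))))))
                                                 (sumTo-neg (suc n) (term i′))))
                      (sumTo-neg 4 (λ i′ → sumTo (suc n) (term i′)))
    where
    term : ℕ → ℕ → ℚ
    term i′ k = ℕ→ℚ (suc i′) * r (suc i′) k * inv (pow (t + ℕ→ℚ k) (suc (suc i′)))
    lemma : ∀ a m c → a * - (m * c) ≡ - (m * a * c)
    lemma = solve 3 (λ a m c → a :* :- (m :* c) := :- (m :* a :* c)) refl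

Rn′-halfInteger : ∀ n r → IsPartialFraction n r → ∀ x → Rn′ n (ℕ→ℚ x + ½) ≡ partialFraction′ n r (ℕ→ℚ x + ½)
Rn′-halfInteger n r isPF x = hasDeriv₂-unique
  (isPF (ℕ→ℚ x + ½) (λ k _ → halfInteger-+-≢0 x k))
  (λ M → isPF (ℕ→ℚ x + ½ + pow2 M) (λ k _ → halfInteger-+pow2-≢0 x k M))
  (hasDeriv₂-Rn n x) (hasDeriv₂-partialFraction n r x)

-- Behaviour at 2-adic infinity

tiny : ℕ → ℚ
tiny L = pow2 (suc (suc L))

huge : ℕ → ℚ
huge L = inv (tiny L)

onePlusTiny : ℕ → ℚ → ℚ
onePlusTiny L a = 1ℚ + a * tiny L

huge-*-tiny : ∀ L → huge L * tiny L ≡ 1ℚ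
huge-*-tiny L = *-invˡ (tiny L) (pow2-≢0 (suc (suc L)))

huge-≢0 : ∀ L → huge L ≢ 0ℚ
huge-≢0 L huge≡0 = ℚP.1≢0 (trans (sym (huge-*-tiny L)) (trans (cong (_* tiny L) huge≡0) (ℚP.*-zeroˡ (tiny L))))

inv-huge : ∀ L → inv (huge L) ≡ tiny L
inv-huge L = inv-unique (huge L) (tiny L) (huge-*-tiny L)

huge-+ : ∀ L a → huge L + a ≡ huge L * onePlusTiny L a
huge-+ L a = begin
  huge L + a                       ≡⟨ cong (huge L +_) (sym (trans (cong (a *_) (huge-*-tiny L)) (ℚP.*-identityʳ a))) ⟩
  huge L + a * (huge L * tiny L)   ≡⟨ lemma (huge L) (tiny L) a ⟩
  huge L * onePlusTiny L a         ∎
  where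
  lemma : ∀ t s a → t + a * (t * s) ≡ t * (1ℚ + a * s)
  lemma = solve 3 (λ t s a → t :+ a :* (t :* s) := t :* (con 1ℚ :+ a :* s)) refl

onePlusTiny-ℕ≡oddℚ : ∀ L k → onePlusTiny L (ℕ→ℚ k) ≡ oddℚ (k ℕ.* 2 ^ suc L)
onePlusTiny-ℕ≡oddℚ L k = sym (begin
  ℕ→ℚ (suc (2 ℕ.* (k ℕ.* 2 ^ suc L)))
    ≡⟨ ℕ→ℚ-suc (2 ℕ.* (k ℕ.* 2 ^ suc L)) ⟩
  1ℚ + ℕ→ℚ (2 ℕ.* (k ℕ.* 2 ^ suc L))
    ≡⟨ cong (1ℚ +_) (trans (ℕ→ℚ-* 2 (k ℕ.* 2 ^ suc L)) (cong (ℕ→ℚ 2 *_) (ℕ→ℚ-* k (2 ^ suc L)))) ⟩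
  1ℚ + ℕ→ℚ 2 * (ℕ→ℚ k * ℕ→ℚ (2 ^ suc L))
    ≡⟨ cong (λ z → 1ℚ + ℕ→ℚ 2 * (ℕ→ℚ k * z)) (ℕ→ℚ-^ 2 (suc L)) ⟩
  1ℚ + ℕ→ℚ 2 * (ℕ→ℚ k * pow2 (suc L))
    ≡⟨ lemma (ℕ→ℚ k) (pow2 (suc L)) ⟩
  onePlusTiny L (ℕ→ℚ k) ∎)
  where
  lemma : ∀ k p → 1ℚ + ℕ→ℚ 2 * (k * p) ≡ 1ℚ + k * (ℕ→ℚ 2 * p)
  lemma = solve 2 (λ k p → con 1ℚ :+ con (ℕ→ℚ 2) :* (k :* p) := con 1ℚ :+ k :* (con (ℕ→ℚ 2) :* p)) refl

onePlusTiny-ℕ-≢0 : ∀ L k → onePlusTiny L (ℕ→ℚ k) ≢ 0ℚ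
onePlusTiny-ℕ-≢0 L k e = oddℚ-≢0 (k ℕ.* 2 ^ suc L) (trans (sym (onePlusTiny-ℕ≡oddℚ L k)) e)

ℤ₍₂₎-inv-onePlusTiny-ℕ : ∀ L k → ℤ₍₂₎ (inv (onePlusTiny L (ℕ→ℚ k)))
ℤ₍₂₎-inv-onePlusTiny-ℕ L k = subst (λ z → ℤ₍₂₎ (inv z)) (sym (onePlusTiny-ℕ≡oddℚ L k)) (ℤ₍₂₎-inv-oddℚ (k ℕ.* 2 ^ suc L))

ℤ₍₂₎-onePlusTiny-half : ∀ L j → ℤ₍₂₎ (onePlusTiny L (½ + ℕ→ℚ j))
ℤ₍₂₎-onePlusTiny-half L j = subst ℤ₍₂₎ (lemma (pow2 (suc L)) (ℕ→ℚ j))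
  (ℤ₍₂₎-+ (ℤ₍₂₎-+ (ℤ₍₂₎-ℕ 1) (ℤ₍₂₎-pow2 (suc L))) (ℤ₍₂₎-* (ℤ₍₂₎-ℕ j) (ℤ₍₂₎-pow2 (suc (suc L)))))
  where
  lemma : ∀ p j → 1ℚ + p + j * (ℕ→ℚ 2 * p) ≡ 1ℚ + (½ + j) * (ℕ→ℚ 2 * p)
  lemma = solve 2 (λ p j → con 1ℚ :+ p :+ j :* (con (ℕ→ℚ 2) :* p) := con 1ℚ :+ (con ½ :+ j) :* (con (ℕ→ℚ 2) :* p)) refl

huge*invPow : ∀ L k i → huge L * inv (pow (huge L + ℕ→ℚ k) (suc i)) ≡ pow (tiny L) i * pow (inv (onePlusTiny L (ℕ→ℚ k))) (suc i)
huge*invPow L k i = begin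
  t * inv (pow (t + ℕ→ℚ k) (suc i))
    ≡⟨ cong (λ z → t * inv (pow z (suc i))) (huge-+ L (ℕ→ℚ k)) ⟩
  t * inv (pow (t * B) (suc i))
    ≡⟨ cong (t *_) (inv-pow (t * B) (suc i) (*-≢0 (huge-≢0 L) (onePlusTiny-ℕ-≢0 L k))) ⟩
  t * pow (inv (t * B)) (suc i)
    ≡⟨ cong (λ z → t * pow z (suc i)) (trans (inv-* t B (huge-≢0 L) (onePlusTiny-ℕ-≢0 L k)) (cong (_* inv B) (inv-huge L))) ⟩
  t * pow (s * inv B) (suc i)
    ≡⟨ cong (t *_) (pow-distrib-* s (inv B) (suc i)) ⟩
  t * (s * pow s i * pow (inv B) (suc i)) ≡⟨ lemma t s (pow s i) (pow (inv B) (suc i)) ⟩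
  (t * s) * (pow s i * pow (inv B) (suc i)) ≡⟨ cong (_* (pow s i * pow (inv B) (suc i))) (huge-*-tiny L) ⟩
  1ℚ * (pow s i * pow (inv B) (suc i))   ≡⟨ ℚP.*-identityˡ _ ⟩
  pow s i * pow (inv B) (suc i)          ∎
  where
  t = huge L
  s = tiny L
  B = onePlusTiny L (ℕ→ℚ k)
  lemma : ∀ t s a b → t * (s * a * b) ≡ (t * s) * (a * b)
  lemma = solve 4 (λ t s a b → t :* (s :* a :* b) := (t :* s) :* (a :* b)) refl

huge*invPow-tends0 : ∀ k i → Tends0₂ (λ L → huge L * inv (pow (huge L + ℕ→ℚ k) (suc (suc i))))
huge*invPow-tends0 k i = tends0-fromVal≥ 0 (λ L → subst (Val≥ L 0) (sym (trans (huge*invPow L k (suc i))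
    (ℚP.*-assoc (tiny L) (pow (tiny L) i) _)))
  (Val≥-weakenᵐ (ℕP.m≤n+m L 2) (Val≥-*ℤ₍₂₎ (Val≥-pow2 (suc (suc L)))
    (ℤ₍₂₎-* (ℤ₍₂₎-pow i (ℤ₍₂₎-pow2 (suc (suc L)))) (ℤ₍₂₎-pow (suc (suc i)) (ℤ₍₂₎-inv-onePlusTiny-ℕ L k))))))

huge*inv-tends1 : ∀ k → Tends0₂ (λ L → huge L * inv (pow (huge L + ℕ→ℚ k) 1) - 1ℚ)
huge*inv-tends1 k = tends0-fromVal≥ 0 (λ L → subst (Val≥ L 0) (sym (remainder L))
  (Val≥-weakenᵐ (ℕP.m≤n+m L 2)
    (Val≥-*ℤ₍₂₎ (Val≥-pow2 (suc (suc L))) (ℤ₍₂₎-* (ℤ₍₂₎-neg (ℤ₍₂₎-ℕ k)) (ℤ₍₂₎-inv-onePlusTiny-ℕ L k)))))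
  where
  remainder : ∀ L → huge L * inv (pow (huge L + ℕ→ℚ k) 1) - 1ℚ ≡ tiny L * (- ℕ→ℚ k * inv (onePlusTiny L (ℕ→ℚ k)))
  remainder L = begin
    huge L * inv (pow (huge L + ℕ→ℚ k) 1) - 1ℚ
      ≡⟨ cong (_- 1ℚ) (huge*invPow L k 0) ⟩
    1ℚ * (inv B * 1ℚ) - 1ℚ
      ≡⟨ cong (λ z → 1ℚ * (inv B * 1ℚ) - z) (sym (*-invˡ B (onePlusTiny-ℕ-≢0 L k))) ⟩
    1ℚ * (inv B * 1ℚ) - inv B * B
      ≡⟨ lemma (inv B) (ℕ→ℚ k) (tiny L) ⟩
    tiny L * (- ℕ→ℚ k * inv B) ∎
    where
    B = onePlusTiny L (ℕ→ℚ k)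
    lemma : ∀ i k s → 1ℚ * (i * 1ℚ) - i * (1ℚ + k * s) ≡ s * (- k * i)
    lemma = solve 3 (λ i k s → con 1ℚ :* (i :* con 1ℚ) :- i :* (con 1ℚ :+ k :* s) := s :* (:- k :* i)) refl

prodTo-huge-+ : ∀ L m (a : ℕ → ℚ) → prodTo m (λ j → huge L + a j) ≡ pow (huge L) m * prodTo m (λ j → onePlusTiny L (a j))
prodTo-huge-+ L m a = begin
  prodTo m (λ j → huge L + a j)                           ≡⟨ prodTo-cong m (λ j → huge-+ L (a j)) ⟩
  prodTo m (λ j → huge L * onePlusTiny L (a j))           ≡⟨ prodTo-* m (λ _ → huge L) (λ j → onePlusTiny L (a j)) ⟩
  prodTo m (λ _ → huge L) * prodTo m (λ j → onePlusTiny L (a j))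
    ≡⟨ cong (_* prodTo m (λ j → onePlusTiny L (a j))) (prodTo-const m (huge L)) ⟩
  pow (huge L) m * prodTo m (λ j → onePlusTiny L (a j))   ∎

inv-pow-huge-* : ∀ L m e {x} → x ≢ 0ℚ → inv (pow (pow (huge L) m * x) e) ≡ pow (pow (tiny L) m * inv x) e
inv-pow-huge-* L m e {x} x≢0 = begin
  inv (pow (pow (huge L) m * x) e)          ≡⟨ inv-pow _ e (*-≢0 tᵐ≢0 x≢0) ⟩
  pow (inv (pow (huge L) m * x)) e          ≡⟨ cong (λ z → pow z e) (inv-* (pow (huge L) m) x tᵐ≢0 x≢0) ⟩
  pow (inv (pow (huge L) m) * inv x) e      ≡⟨ cong (λ z → pow (z * inv x) e) (inv-pow (huge L) m (huge-≢0 L)) ⟩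
  pow (pow (inv (huge L)) m * inv x) e      ≡⟨ cong (λ z → pow (pow z m * inv x) e) (inv-huge L) ⟩
  pow (pow (tiny L) m * inv x) e            ∎
  where
  tᵐ≢0 : pow (huge L) m ≢ 0ℚ
  tᵐ≢0 = pow-≢0 m (huge-≢0 L)

huge*Rn≡ : ∀ n L → let s = tiny L
                       ΠA = prodTo n (λ j → onePlusTiny L (½ + ℕ→ℚ j))
                       ΠB = prodTo (suc n) (λ k → onePlusTiny L (ℕ→ℚ k)) in
  huge L * Rn n (huge L) ≡ s * s * (pow2 (8 ℕ.* n) * (ℕ→ℚ n * s + ℕ→ℚ 2) * pow ΠA 4 * pow (inv ΠB) 4)
huge*Rn≡ n L = begin
  t * Rn n t
    ≡⟨ cong₂ (λ a b → t * (a * inv b)) (evalP-numR n t) (evalP-denR n t) ⟩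
  t * (c * ((ℕ→ℚ n + ℕ→ℚ 2 * t) * pow (prodTo n (λ j → t + (½ + ℕ→ℚ j))) 4) * inv (pow (prodTo (suc n) (λ j → t + ℕ→ℚ j)) 4))
    ≡⟨ cong₂ (λ a b → t * (c * ((ℕ→ℚ n + ℕ→ℚ 2 * t) * pow a 4) * inv (pow b 4)))
         (prodTo-huge-+ L n (λ j → ½ + ℕ→ℚ j)) (prodTo-huge-+ L (suc n) ℕ→ℚ) ⟩
  t * (c * ((ℕ→ℚ n + ℕ→ℚ 2 * t) * pow (pow t n * ΠA) 4) * inv (pow (pow t (suc n) * ΠB) 4))
    ≡⟨ cong₂ (λ a b → t * (c * (a * pow (pow t n * ΠA) 4) * b)) n+2t≡ (inv-pow-huge-* L (suc n) 4 ΠB≢0) ⟩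
  t * (c * ((t * X) * pow (pow t n * ΠA) 4) * pow (s * pow s n * inv ΠB) 4)
    ≡⟨ lemma t s (pow t n) (pow s n) c X ΠA (inv ΠB) ⟩
  (t * s) * (t * s) * pow (pow t n * pow s n) 4 * (s * s * (c * X * pow ΠA 4 * pow (inv ΠB) 4))
    ≡⟨ cong₂ (λ a b → a * a * pow b 4 * (s * s * (c * X * pow ΠA 4 * pow (inv ΠB) 4))) (huge-*-tiny L)
         (trans (sym (pow-distrib-* t s n)) (trans (cong (λ z → pow z n) (huge-*-tiny L)) (pow-1ℚ n))) ⟩
  1ℚ * 1ℚ * pow 1ℚ 4 * (s * s * (c * X * pow ΠA 4 * pow (inv ΠB) 4))
    ≡⟨ solve 1 (λ z → con 1ℚ :* con 1ℚ :* con 1ℚ :^ 4 :* z := z) refl (s * s * (c * X * pow ΠA 4 * pow (inv ΠB) 4)) ⟩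
  s * s * (c * X * pow ΠA 4 * pow (inv ΠB) 4) ∎
  where
  t = huge L
  s = tiny L
  c = pow2 (8 ℕ.* n)
  X = ℕ→ℚ n * s + ℕ→ℚ 2
  ΠA = prodTo n (λ j → onePlusTiny L (½ + ℕ→ℚ j))
  ΠB = prodTo (suc n) (λ k → onePlusTiny L (ℕ→ℚ k))
  ΠB≢0 : ΠB ≢ 0ℚ
  ΠB≢0 = prodTo-≢0 (suc n) (λ k → onePlusTiny L (ℕ→ℚ k)) (λ k _ → onePlusTiny-ℕ-≢0 L k)
  n+2t≡ : ℕ→ℚ n + ℕ→ℚ 2 * t ≡ t * X
  n+2t≡ = begin
    ℕ→ℚ n + ℕ→ℚ 2 * t
      ≡⟨ cong (λ z → z + ℕ→ℚ 2 * t) (sym (trans (cong (ℕ→ℚ n *_) (huge-*-tiny L)) (ℚP.*-identityʳ (ℕ→ℚ n)))) ⟩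
    ℕ→ℚ n * (t * s) + ℕ→ℚ 2 * t
      ≡⟨ solve 3 (λ a t s → a :* (t :* s) :+ con (ℕ→ℚ 2) :* t := t :* (a :* s :+ con (ℕ→ℚ 2))) refl (ℕ→ℚ n) t s ⟩
    t * X ∎
  lemma : ∀ t s a b c X A iB →
    t * (c * ((t * X) * pow (a * A) 4) * pow (s * b * iB) 4)
    ≡ (t * s) * (t * s) * pow (a * b) 4 * (s * s * (c * X * pow A 4 * pow iB 4))
  lemma = solve 8 (λ t s a b c X A iB →
    t :* (c :* ((t :* X) :* (a :* A) :^ 4) :* (s :* b :* iB) :^ 4)
    := (t :* s) :* (t :* s) :* (a :* b) :^ 4 :* (s :* s :* (c :* X :* A :^ 4 :* iB :^ 4))) refl

huge*Rn-tends0 : ∀ n → Tends0₂ (λ L → huge L * Rn n (huge L))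
huge*Rn-tends0 n = tends0-fromVal≥ 0 (λ L → subst (Val≥ L 0) (sym (huge*Rn≡ n L))
  (Val≥-weakenᵐ (ℕP.≤-trans (ℕP.m≤n+m L 2) (ℕP.m≤m+n (suc (suc L)) (suc (suc L))))
    (Val≥-*ℤ₍₂₎ (Val≥-* (Val≥-pow2 (suc (suc L))) (Val≥-pow2 (suc (suc L))))
      (ℤ₍₂₎-* (ℤ₍₂₎-* (ℤ₍₂₎-* (ℤ₍₂₎-pow2 (8 ℕ.* n)) (ℤ₍₂₎-+ (ℤ₍₂₎-* (ℤ₍₂₎-ℕ n) (ℤ₍₂₎-pow2 (suc (suc L)))) 2∈))
                      (ℤ₍₂₎-pow 4 (ℤ₍₂₎-prodTo n (ℤ₍₂₎-onePlusTiny-half L))))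
              (ℤ₍₂₎-pow 4 (subst ℤ₍₂₎ (sym (inv-prodTo (suc n) _ (λ k _ → onePlusTiny-ℕ-≢0 L k)))
                                  (ℤ₍₂₎-prodTo (suc n) (ℤ₍₂₎-inv-onePlusTiny-ℕ L))))))))
  where
  2∈ = ℤ₍₂₎-ℕ 2

huge-+-≢0 : ∀ L k → huge L + ℕ→ℚ k ≢ 0ℚ
huge-+-≢0 L k e = *-≢0 (huge-≢0 L) (onePlusTiny-ℕ-≢0 L k) (trans (sym (huge-+ L (ℕ→ℚ k))) e)

*-partialFraction : ∀ n r c y → c * partialFraction n r y
  ≡ sumTo 4 (λ i′ → sumTo (suc n) (λ k → r (suc i′) k * (c * inv (pow (y + ℕ→ℚ k) (suc i′)))))
*-partialFraction n r c y = trans (sym (sumTo-*ˡ 4 c (λ i′ → sumTo (suc n) (term i′))))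
  (sumTo-cong 4 (λ i′ → trans (sym (sumTo-*ˡ (suc n) c (term i′)))
    (sumTo-cong (suc n) (λ k → ℚ*.x∙yz≈y∙xz c (r (suc i′) k) (inv (pow (y + ℕ→ℚ k) (suc i′)))))))
  where
  term : ℕ → ℕ → ℚ
  term i′ k = r (suc i′) k * inv (pow (y + ℕ→ℚ k) (suc i′))

huge*partialFraction-tends : ∀ n r → Tends0₂ (λ L → huge L * partialFraction n r (huge L) - sumTo (suc n) (r 1))
huge*partialFraction-tends n r = tends0-cong (λ L → sym (decomposition L))
  (tends0-+ {λ L → U L + T 1 L + T 2 L} {T 3} (tends0-+ {λ L → U L + T 1 L} {T 2} (tends0-+ {U} {T 1}
    (tends0-sumTo (suc n) (λ k → tends0-*ˡ (r 1 k) (huge*inv-tends1 k))) (T-tends0 0)) (T-tends0 1)) (T-tends0 2))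
  where
  S = sumTo (suc n) (r 1)
  T : ℕ → ℕ → ℚ
  T i′ L = sumTo (suc n) (λ k → r (suc i′) k * (huge L * inv (pow (huge L + ℕ→ℚ k) (suc i′))))
  U : ℕ → ℚ
  U L = sumTo (suc n) (λ k → r 1 k * (huge L * inv (pow (huge L + ℕ→ℚ k) 1) - 1ℚ))
  T-tends0 : ∀ i′ → Tends0₂ (T (suc i′))
  T-tends0 i′ = tends0-sumTo (suc n) (λ k → tends0-*ˡ (r (suc (suc i′)) k) (huge*invPow-tends0 k i′))
  T₀-S≡U : ∀ L → T 0 L - S ≡ U L
  T₀-S≡U L = trans (sym (sumTo-- (suc n) (λ k → r 1 k * (huge L * inv (pow (huge L + ℕ→ℚ k) 1))) (r 1)))
    (sumTo-cong (suc n) (λ k → solve 2 (λ a b → a :* b :- a := a :* (b :- con 1ℚ)) refl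
                                       (r 1 k) (huge L * inv (pow (huge L + ℕ→ℚ k) 1))))
  decomposition : ∀ L → huge L * partialFraction n r (huge L) - S ≡ U L + T 1 L + T 2 L + T 3 L
  decomposition L = begin
    huge L * partialFraction n r (huge L) - S   ≡⟨ cong (_- S) (*-partialFraction n r (huge L) (huge L)) ⟩
    0ℚ + T 0 L + T 1 L + T 2 L + T 3 L - S
      ≡⟨ solve 5 (λ a b c d s → con 0ℚ :+ a :+ b :+ c :+ d :- s := (a :- s) :+ b :+ c :+ d) refl (T 0 L) (T 1 L) (T 2 L) (T 3 L) S ⟩
    (T 0 L - S) + T 1 L + T 2 L + T 3 L         ≡⟨ cong (λ z → z + T 1 L + T 2 L + T 3 L) (T₀-S≡U L) ⟩
    U L + T 1 L + T 2 L + T 3 L                 ∎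

-- t R_n(t) → 0 as t → ∞ 2-adically (R_n has degree −3), while t times the partial fractions
-- tends to Σ_k r_{n,1,k}.
residue-sum : ∀ n r → IsPartialFraction n r → sumTo (suc n) (r 1) ≡ 0ℚ
residue-sum n r isPF = tends0-const⇒0 S (tends0-cong difference
  (tends0-- {λ L → huge L * Rn n (huge L)} {λ L → huge L * partialFraction n r (huge L) - S}
    (huge*Rn-tends0 n) (huge*partialFraction-tends n r)))
  where
  S = sumTo (suc n) (r 1)
  difference : ∀ L → huge L * Rn n (huge L) - (huge L * partialFraction n r (huge L) - S) ≡ S
  difference L = begin
    huge L * Rn n (huge L) - (huge L * partialFraction n r (huge L) - S)
      ≡⟨ cong (λ z → huge L * z - (huge L * partialFraction n r (huge L) - S)) (isPF (huge L) (λ k _ → huge-+-≢0 L k)) ⟩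
    huge L * partialFraction n r (huge L) - (huge L * partialFraction n r (huge L) - S)
      ≡⟨ solve 2 (λ a s → a :- (a :- s) := s) refl (huge L * partialFraction n r (huge L)) S ⟩
    S ∎

invOddPow : ℕ → ℕ → ℚ
invOddPow m x = pow (inv (oddℚ x)) m

ℤ₍₂₎-invOddPow : ∀ m x → ℤ₍₂₎ (invOddPow m x)
ℤ₍₂₎-invOddPow m x = ℤ₍₂₎-pow m (ℤ₍₂₎-inv-oddℚ x)

oddSum : ℕ → ℕ → ℚ
oddSum N m = sumTo (2 ^ N) (invOddPow m)

-- The N-th Volkenborn Riemann sum of (1 + 2t)^-m.
oddMean : ℕ → ℕ → ℚ
oddMean N m = inv (pow2 N) * oddSum N m

invOddPow-shift : ∀ N j x → let H = pow2 (suc N) in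
  invOddPow (suc j) (2 ^ N ℕ.+ x) ≡ invOddPow (suc j) x - ℕ→ℚ (suc j) * H * invOddPow (suc (suc j)) x + H * H * oddRem N j x
invOddPow-shift N j x = begin
  pow (inv (oddℚ (2 ^ N ℕ.+ x))) (suc j)
    ≡⟨ cong (λ z → pow (inv z) (suc j)) (oddℚ-shift N x) ⟩
  pow (inv (oddℚ x + H)) (suc j)
    ≡⟨ lemma₁ (pow (inv (oddℚ x + H)) (suc j)) (invOddPow (suc j) x) D ⟩
  (pow (inv (oddℚ x + H)) (suc j) - invOddPow (suc j) x + D) + invOddPow (suc j) x - D
    ≡⟨ cong (λ z → z + invOddPow (suc j) x - D) (invPow-expansion j (oddℚ x) H (oddℚ-≢0 x) (oddℚ-shift-≢0 N x)) ⟩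
  H * H * oddRem N j x + invOddPow (suc j) x - D
    ≡⟨ lemma₂ (H * H * oddRem N j x) (invOddPow (suc j) x) D ⟩
  invOddPow (suc j) x - D + H * H * oddRem N j x ∎
  where
  H = pow2 (suc N)
  D = ℕ→ℚ (suc j) * H * invOddPow (suc (suc j)) x
  lemma₁ : ∀ a b c → a ≡ (a - b + c) + b - c
  lemma₁ = solve 3 (λ a b c → a := (a :- b :+ c) :+ b :- c) refl
  lemma₂ : ∀ a b c → a + b - c ≡ b - c + a
  lemma₂ = solve 3 (λ a b c → a :+ b :- c := b :- c :+ a) refl

oddSum-step : ∀ N j → let H = pow2 (suc N) in
  oddSum (suc N) (suc j) ≡ ℕ→ℚ 2 * oddSum N (suc j) - ℕ→ℚ (suc j) * H * oddSum N (suc (suc j)) + H * H * sumTo (2 ^ N) (oddRem N j)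
oddSum-step N j = begin
  sumTo (2 ^ N ℕ.+ (2 ^ N ℕ.+ 0)) f
    ≡⟨ cong (λ z → sumTo (2 ^ N ℕ.+ z) f) (ℕP.+-identityʳ (2 ^ N)) ⟩
  sumTo (2 ^ N ℕ.+ 2 ^ N) f
    ≡⟨ sumTo-++ (2 ^ N) (2 ^ N) f ⟩
  E + sumTo (2 ^ N) (λ x → f (2 ^ N ℕ.+ x))
    ≡⟨ cong (E +_) (sumTo-cong (2 ^ N) (invOddPow-shift N j)) ⟩
  E + sumTo (2 ^ N) (λ x → f x - c * g x + d * oddRem N j x)
    ≡⟨ cong (E +_) (trans (sumTo-+ (2 ^ N) (λ x → f x - c * g x) (λ x → d * oddRem N j x))
         (cong₂ _+_ (trans (sumTo-- (2 ^ N) f (λ x → c * g x)) (cong (λ z → E - z) (sumTo-*ˡ (2 ^ N) c g)))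
                    (sumTo-*ˡ (2 ^ N) d (oddRem N j)))) ⟩
  E + (E - c * oddSum N (suc (suc j)) + d * sumTo (2 ^ N) (oddRem N j))
    ≡⟨ lemma E (c * oddSum N (suc (suc j))) (d * sumTo (2 ^ N) (oddRem N j)) ⟩
  ℕ→ℚ 2 * E - c * oddSum N (suc (suc j)) + d * sumTo (2 ^ N) (oddRem N j) ∎
  where
  f = invOddPow (suc j)
  g = invOddPow (suc (suc j))
  E = oddSum N (suc j)
  c = ℕ→ℚ (suc j) * pow2 (suc N)
  d = pow2 (suc N) * pow2 (suc N)
  lemma : ∀ a b e → a + (a - b + e) ≡ ℕ→ℚ 2 * a - b + e
  lemma = solve 3 (λ a b e → a :+ (a :- b :+ e) := con (ℕ→ℚ 2) :* a :- b :+ e) refl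

oddSum-Val≥ : ∀ N m → Val≥ N 0 (oddSum N m)
oddSum-Val≥ N zero = subst (Val≥ N 0) (sym (trans (sumTo-1 (2 ^ N)) (ℕ→ℚ-^ 2 N))) (Val≥-pow2 N)
oddSum-Val≥ zero (suc j) = Val≥-ℤ₍₂₎ (ℤ₍₂₎-sumTo 1 (ℤ₍₂₎-invOddPow (suc j)))
oddSum-Val≥ (suc N) (suc j) = subst (Val≥ (suc N) 0) (sym (oddSum-step N j)) (Val≥-+ (Val≥-- doubled first-order) second-order)
  where
  doubled : Val≥ (suc N) 0 (ℕ→ℚ 2 * oddSum N (suc j))
  doubled = Val≥-* (Val≥-pow2 1) (oddSum-Val≥ N (suc j))
  first-order : Val≥ (suc N) 0 (ℕ→ℚ (suc j) * pow2 (suc N) * oddSum N (suc (suc j)))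
  first-order = Val≥-weakenᵐ (ℕP.m≤m+n (suc N) N)
    (Val≥-* (Val≥-* (Val≥-ℤ₍₂₎ (ℤ₍₂₎-ℕ (suc j))) (Val≥-pow2 (suc N))) (oddSum-Val≥ N (suc (suc j))))
  second-order : Val≥ (suc N) 0 (pow2 (suc N) * pow2 (suc N) * sumTo (2 ^ N) (oddRem N j))
  second-order = Val≥-weakenᵐ (ℕP.≤-trans (ℕP.m≤m+n (suc N) (suc N)) (ℕP.m≤m+n (suc N ℕ.+ suc N) 0))
    (Val≥-* (Val≥-* (Val≥-pow2 (suc N)) (Val≥-pow2 (suc N))) (Val≥-ℤ₍₂₎ (ℤ₍₂₎-sumTo (2 ^ N) (ℤ₍₂₎-oddRem N j))))

oddℚ-reflect : ∀ N x → x < 2 ^ N → oddℚ (2 ^ N ∸ suc x) ≡ - (oddℚ x + - pow2 (suc N))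
oddℚ-reflect N x x<2^N = begin
  oddℚ y                       ≡⟨ lemma (oddℚ y) (oddℚ x) ⟩
  oddℚ y + oddℚ x - oddℚ x     ≡⟨ cong (_- oddℚ x) (sym (ℕ→ℚ-+ (odd y) (odd x))) ⟩
  ℕ→ℚ (odd y ℕ.+ odd x) - oddℚ x  ≡⟨ cong (λ z → ℕ→ℚ z - oddℚ x) odd-sum ⟩
  ℕ→ℚ (2 ^ suc N) - oddℚ x    ≡⟨ cong (_- oddℚ x) (ℕ→ℚ-^ 2 (suc N)) ⟩
  pow2 (suc N) - oddℚ x        ≡⟨ solve 2 (λ H u → H :- u := :- (u :+ :- H)) refl (pow2 (suc N)) (oddℚ x) ⟩
  - (oddℚ x + - pow2 (suc N))  ∎
  where
  y = 2 ^ N ∸ suc x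
  lemma : ∀ a b → a ≡ a + b - b
  lemma = solve 2 (λ a b → a := a :+ b :- b) refl
  odd-sum : odd y ℕ.+ odd x ≡ 2 ^ suc N
  odd-sum = begin
    suc (2 ℕ.* y) ℕ.+ suc (2 ℕ.* x)      ≡⟨ cong suc (ℕP.+-suc (2 ℕ.* y) (2 ℕ.* x)) ⟩
    suc (suc (2 ℕ.* y ℕ.+ 2 ℕ.* x))      ≡⟨ cong (λ z → suc (suc z)) (sym (ℕP.*-distribˡ-+ 2 y x)) ⟩
    suc (suc (2 ℕ.* (y ℕ.+ x)))          ≡⟨ sym (ℕP.*-suc 2 (y ℕ.+ x)) ⟩
    2 ℕ.* suc (y ℕ.+ x)                  ≡⟨ cong (2 ℕ.*_) (sym (ℕP.+-suc y x)) ⟩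
    2 ℕ.* (y ℕ.+ suc x)                  ≡⟨ cong (2 ℕ.*_) (ℕP.m∸n+n≡m x<2^N) ⟩
    2 ^ suc N                            ∎

invOddPow-pair : ∀ N k x → x < 2 ^ N → let m = suc (2 ℕ.* k); H = pow2 (suc N) in
  invOddPow m x + invOddPow m (2 ^ N ∸ suc x) ≡ - (ℕ→ℚ m * H * invOddPow (suc m) x + H * H * invPowRem (2 ℕ.* k) (oddℚ x) (- H))
invOddPow-pair N k x x<2^N = begin
  P x + pow (inv (oddℚ (2 ^ N ∸ suc x))) m        ≡⟨ cong (λ z → P x + pow (inv z) m) reflect≡ ⟩
  P x + pow (inv (- (u + - H))) m                 ≡⟨ cong (λ z → P x + pow z m) (inv-neg (u + - H)) ⟩
  P x + pow (- inv (u + - H)) m                   ≡⟨ cong (P x +_) (pow-neg-odd (inv (u + - H)) k) ⟩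
  P x + - pow (inv (u + - H)) m                   ≡⟨ lemma₁ (P x) (pow (inv (u + - H)) m) (ℕ→ℚ m * - H * P′) ⟩
  - (pow (inv (u + - H)) m - P x + ℕ→ℚ m * - H * P′) + ℕ→ℚ m * - H * P′
    ≡⟨ cong (λ z → - z + ℕ→ℚ m * - H * P′) (invPow-expansion (2 ℕ.* k) u (- H) (oddℚ-≢0 x) u-H≢0) ⟩
  - (- H * - H * W) + ℕ→ℚ m * - H * P′            ≡⟨ lemma₂ (ℕ→ℚ m) H P′ W ⟩
  - (ℕ→ℚ m * H * P′ + H * H * W)                  ∎
  where
  m = suc (2 ℕ.* k)
  H = pow2 (suc N)
  u = oddℚ x
  P = invOddPow m
  P′ = invOddPow (suc m) x
  W = invPowRem (2 ℕ.* k) u (- H)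
  reflect≡ = oddℚ-reflect N x x<2^N
  u-H≢0 : u + - H ≢ 0ℚ
  u-H≢0 e = oddℚ-≢0 (2 ^ N ∸ suc x) (trans reflect≡ (cong -_ e))
  lemma₁ : ∀ a b c → a + - b ≡ - (b - a + c) + c
  lemma₁ = solve 3 (λ a b c → a :+ :- b := :- (b :- a :+ c) :+ c) refl
  lemma₂ : ∀ m H b W → - (- H * - H * W) + m * - H * b ≡ - (m * H * b + H * H * W)
  lemma₂ = solve 4 (λ m H b W → :- (:- H :* :- H :* W) :+ m :* :- H :* b := :- (m :* H :* b :+ H :* H :* W)) refl

ℤ₍₂₎-inv-oddℚ-reflect : ∀ N x → x < 2 ^ N → ℤ₍₂₎ (inv (oddℚ x + - pow2 (suc N)))
ℤ₍₂₎-inv-oddℚ-reflect N x x<2^N = subst ℤ₍₂₎ inv≡ (ℤ₍₂₎-neg (ℤ₍₂₎-inv-oddℚ (2 ^ N ∸ suc x)))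
  where
  inv≡ : - inv (oddℚ (2 ^ N ∸ suc x)) ≡ inv (oddℚ x + - pow2 (suc N))
  inv≡ = begin
    - inv (oddℚ (2 ^ N ∸ suc x))           ≡⟨ cong (λ z → - inv z) (oddℚ-reflect N x x<2^N) ⟩
    - inv (- (oddℚ x + - pow2 (suc N)))    ≡⟨ cong -_ (inv-neg (oddℚ x + - pow2 (suc N))) ⟩
    - - inv (oddℚ x + - pow2 (suc N))      ≡⟨ solve 1 (λ a → :- :- a := a) refl (inv (oddℚ x + - pow2 (suc N))) ⟩
    inv (oddℚ x + - pow2 (suc N))          ∎

-- Pairing 2y + 1 with 2^{N+1} − (2y + 1), the two terms cancel up to 2^{N+1} times a sum of valuation ≥ N.
oddSum-oddExp-Val≥ : ∀ N k → Val≥ (N ℕ.+ N) 0 (oddSum N (suc (2 ℕ.* k)))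
oddSum-oddExp-Val≥ N k = Val≥-half (subst (Val≥ (suc (N ℕ.+ N)) 0) (sym doubled≡) (Val≥-neg (Val≥-+ first-order second-order)))
  where
  m = suc (2 ℕ.* k)
  H = pow2 (suc N)
  E = oddSum N m
  W′ : ℕ → ℚ
  W′ x = invPowRem (2 ℕ.* k) (oddℚ x) (- H)
  f g : ℕ → ℚ
  f x = ℕ→ℚ m * H * invOddPow (suc m) x
  g x = H * H * W′ x
  doubled≡ : E + E ≡ - (ℕ→ℚ m * H * oddSum N (suc m) + H * H * sumTo (2 ^ N) W′)
  doubled≡ = begin
    E + E
      ≡⟨ cong (E +_) (sumTo-reverse (2 ^ N) (invOddPow m)) ⟩
    E + sumTo (2 ^ N) (λ x → invOddPow m (2 ^ N ∸ suc x))
      ≡⟨ sym (sumTo-+ (2 ^ N) (invOddPow m) (λ x → invOddPow m (2 ^ N ∸ suc x))) ⟩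
    sumTo (2 ^ N) (λ x → invOddPow m x + invOddPow m (2 ^ N ∸ suc x))
      ≡⟨ sumTo-cong-< (2 ^ N) (invOddPow-pair N k) ⟩
    sumTo (2 ^ N) (λ x → - (f x + g x))
      ≡⟨ sumTo-neg (2 ^ N) (λ x → f x + g x) ⟩
    - sumTo (2 ^ N) (λ x → f x + g x)
      ≡⟨ cong -_ (sumTo-+ (2 ^ N) f g) ⟩
    - (sumTo (2 ^ N) f + sumTo (2 ^ N) g)
      ≡⟨ cong₂ (λ a b → - (a + b)) (sumTo-*ˡ (2 ^ N) (ℕ→ℚ m * H) (invOddPow (suc m))) (sumTo-*ˡ (2 ^ N) (H * H) W′) ⟩
    - (ℕ→ℚ m * H * oddSum N (suc m) + H * H * sumTo (2 ^ N) W′) ∎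
  first-order : Val≥ (suc (N ℕ.+ N)) 0 (ℕ→ℚ m * H * oddSum N (suc m))
  first-order = Val≥-* (Val≥-* (Val≥-ℤ₍₂₎ (ℤ₍₂₎-ℕ m)) (Val≥-pow2 (suc N))) (oddSum-Val≥ N (suc m))
  second-order : Val≥ (suc (N ℕ.+ N)) 0 (H * H * sumTo (2 ^ N) W′)
  second-order = Val≥-weakenᵐ (s≤s (ℕP.≤-trans (ℕP.+-monoʳ-≤ N (ℕP.n≤1+n N)) (ℕP.m≤m+n (N ℕ.+ suc N) 0)))
    (Val≥-* (Val≥-* (Val≥-pow2 (suc N)) (Val≥-pow2 (suc N))) (Val≥-sumTo (2 ^ N) (λ x x<2^N → Val≥-ℤ₍₂₎
      (ℤ₍₂₎-invPowRem (2 ℕ.* k) (ℤ₍₂₎-ℕ (odd x)) (ℤ₍₂₎-neg (ℤ₍₂₎-pow2 (suc N))) (ℤ₍₂₎-inv-oddℚ x)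
        (ℤ₍₂₎-inv-oddℚ-reflect N x x<2^N)))))

oddMean-Val≥ : ∀ N m → Val≥ (N ℕ.+ N) 0 (oddSum N m) → Val≥ N 0 (oddMean N m)
oddMean-Val≥ N m sum≥ = Val≥-lower N (subst (λ c → Val≥ (N ℕ.+ N) c (oddMean N m)) (sym (ℕP.+-identityʳ N))
  (Val≥-unscale N (subst (Val≥ (N ℕ.+ N) 0) (sym (pow2-*-inv-cancel N (oddSum N m))) sum≥)))

oddMean-oddExp-tends0 : ∀ k → Tends0₂ (λ N → oddMean N (suc (2 ℕ.* k)))
oddMean-oddExp-tends0 k = tends0-fromVal≥ 0 (λ N → oddMean-Val≥ N (suc (2 ℕ.* k)) (oddSum-oddExp-Val≥ N k))

oddMean-step : ∀ N j → oddMean N (suc j) - oddMean (suc N) (suc j)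
                     ≡ ℕ→ℚ (suc j) * oddSum N (suc (suc j)) - ℕ→ℚ 2 * pow2 N * sumTo (2 ^ N) (oddRem N j)
oddMean-step N j = begin
  i * E - inv (pow2 (suc N)) * oddSum (suc N) (suc j)
    ≡⟨ cong₂ (λ a b → i * E - a * b) (inv-* (ℕ→ℚ 2) (pow2 N) (λ ()) (pow2-≢0 N)) (oddSum-step N j) ⟩
  i * E - (½ * i) * (ℕ→ℚ 2 * E - ℕ→ℚ (suc j) * (ℕ→ℚ 2 * h) * E′ + (ℕ→ℚ 2 * h) * (ℕ→ℚ 2 * h) * W)
    ≡⟨ lemma i h E E′ (ℕ→ℚ (suc j)) W ⟩
  (i * h) * (ℕ→ℚ (suc j) * E′) - (i * h) * (ℕ→ℚ 2 * h * W)
    ≡⟨ cong (λ z → z * (ℕ→ℚ (suc j) * E′) - z * (ℕ→ℚ 2 * h * W)) (*-invˡ h (pow2-≢0 N)) ⟩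
  1ℚ * (ℕ→ℚ (suc j) * E′) - 1ℚ * (ℕ→ℚ 2 * h * W)
    ≡⟨ cong₂ _-_ (ℚP.*-identityˡ (ℕ→ℚ (suc j) * E′)) (ℚP.*-identityˡ (ℕ→ℚ 2 * h * W)) ⟩
  ℕ→ℚ (suc j) * E′ - ℕ→ℚ 2 * h * W ∎
  where
  h = pow2 N
  i = inv h
  E = oddSum N (suc j)
  E′ = oddSum N (suc (suc j))
  W = sumTo (2 ^ N) (oddRem N j)
  lemma : ∀ i h a b f W → i * a - (½ * i) * (ℕ→ℚ 2 * a - f * (ℕ→ℚ 2 * h) * b + (ℕ→ℚ 2 * h) * (ℕ→ℚ 2 * h) * W)
                        ≡ (i * h) * (f * b) - (i * h) * (ℕ→ℚ 2 * h * W)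
  lemma = solve 6 (λ i h a b f W →
    i :* a :- (con ½ :* i) :* (con (ℕ→ℚ 2) :* a :- f :* (con (ℕ→ℚ 2) :* h) :* b :+ (con (ℕ→ℚ 2) :* h) :* (con (ℕ→ℚ 2) :* h) :* W)
    := (i :* h) :* (f :* b) :- (i :* h) :* (con (ℕ→ℚ 2) :* h :* W)) refl

oddMean-successive-tends0 : ∀ j → Tends0₂ (λ N → oddMean N (suc j) - oddMean (suc N) (suc j))
oddMean-successive-tends0 j = tends0-cong (λ N → sym (oddMean-step N j)) (tends0-fromVal≥ 0 (λ N →
  Val≥-- (subst (Val≥ N 0) (ℚP.*-comm (oddSum N (suc (suc j))) (ℕ→ℚ (suc j)))
            (Val≥-*ℤ₍₂₎ (oddSum-Val≥ N (suc (suc j))) (ℤ₍₂₎-ℕ (suc j))))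
         (subst (Val≥ N 0) (lemma (pow2 N) (sumTo (2 ^ N) (oddRem N j)))
           (Val≥-*ℤ₍₂₎ (Val≥-pow2 N) (ℤ₍₂₎-* (ℤ₍₂₎-ℕ 2) (ℤ₍₂₎-sumTo (2 ^ N) (ℤ₍₂₎-oddRem N j)))))))
  where
  lemma : ∀ h W → h * (ℕ→ℚ 2 * W) ≡ ℕ→ℚ 2 * h * W
  lemma = solve 2 (λ h W → h :* (con (ℕ→ℚ 2) :* W) := con (ℕ→ℚ 2) :* h :* W) refl

zeta5Approx≡ : ∀ N → zeta5Approx N ≡ ½ * ½ * ½ * oddMean (suc N) 4
zeta5Approx≡ N = begin
  inv (ℕ→ℚ 16) * (i * sumTo (2 ^ N) f₁ + i * sumTo (2 ^ N) f₃)
    ≡⟨ cong (inv (ℕ→ℚ 16) *_) (sym (ℚP.*-distribˡ-+ i (sumTo (2 ^ N) f₁) (sumTo (2 ^ N) f₃))) ⟩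
  inv (ℕ→ℚ 16) * (i * (sumTo (2 ^ N) f₁ + sumTo (2 ^ N) f₃))
    ≡⟨ cong (λ z → inv (ℕ→ℚ 16) * (i * z)) (sym (sumTo-+ (2 ^ N) f₁ f₃)) ⟩
  inv (ℕ→ℚ 16) * (i * sumTo (2 ^ N) (λ k → f₁ k + f₃ k))
    ≡⟨ cong (λ z → inv (ℕ→ℚ 16) * (i * z)) (trans (sumTo-cong (2 ^ N) (λ k → cong₂ _+_ (f₁≡ k) (f₃≡ k)))
                                                 (sym (sumTo-evenOdd (2 ^ N) (invOddPow 4)))) ⟩
  inv (ℕ→ℚ 16) * (i * oddSum (suc N) 4)
    ≡⟨ lemma i (oddSum (suc N) 4) ⟩
  ½ * ½ * ½ * ((½ * i) * oddSum (suc N) 4)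
    ≡⟨ cong (λ z → ½ * ½ * ½ * (z * oddSum (suc N) 4)) (sym (inv-* (ℕ→ℚ 2) (pow2 N) (λ ()) (pow2-≢0 N))) ⟩
  ½ * ½ * ½ * oddMean (suc N) 4 ∎
  where
  i = inv (pow2 N)
  f₁ f₃ : ℕ → ℚ
  f₁ k = inv (pow (ℕ→ℚ (1 ℕ.+ 4 ℕ.* k)) 4)
  f₃ k = inv (pow (ℕ→ℚ (3 ℕ.+ 4 ℕ.* k)) 4)
  f₁≡ : ∀ k → f₁ k ≡ invOddPow 4 (2 ℕ.* k)
  f₁≡ k = trans (cong (λ z → inv (pow (ℕ→ℚ (suc z)) 4)) (ℕP.*-assoc 2 2 k)) (inv-pow (oddℚ (2 ℕ.* k)) 4 (oddℚ-≢0 (2 ℕ.* k)))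
  f₃≡ : ∀ k → f₃ k ≡ invOddPow 4 (suc (2 ℕ.* k))
  f₃≡ k = trans (cong (λ z → inv (pow (ℕ→ℚ (suc z)) 4))
                      (trans (cong (λ z → suc (suc z)) (ℕP.*-assoc 2 2 k)) (sym (ℕP.*-suc 2 (2 ℕ.* k)))))
    (inv-pow (oddℚ (suc (2 ℕ.* k))) 4 (oddℚ-≢0 (suc (2 ℕ.* k))))
  lemma : ∀ a b → inv (ℕ→ℚ 16) * (a * b) ≡ ½ * ½ * ½ * ((½ * a) * b)
  lemma = solve 2 (λ a b → con (inv (ℕ→ℚ 16)) :* (a :* b) := con ½ :* con ½ :* con ½ :* ((con ½ :* a) :* b)) refl

doubleSum : ℕ → (ℕ → ℕ → ℚ) → ℚ
doubleSum n f = sumTo 4 (λ i′ → sumTo (suc n) (f i′))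

doubleSum-cong : ∀ n {f g : ℕ → ℕ → ℚ} → (∀ i′ k → f i′ k ≡ g i′ k) → doubleSum n f ≡ doubleSum n g
doubleSum-cong n f≡g = sumTo-cong 4 (λ i′ → sumTo-cong (suc n) (f≡g i′))

doubleSum-*ˡ : ∀ n c (f : ℕ → ℕ → ℚ) → doubleSum n (λ i′ k → c * f i′ k) ≡ c * doubleSum n f
doubleSum-*ˡ n c f = trans (sumTo-cong 4 (λ i′ → sumTo-*ˡ (suc n) c (f i′))) (sumTo-*ˡ 4 c (λ i′ → sumTo (suc n) (f i′)))

doubleSum-swap : ∀ n m (f : ℕ → ℕ → ℕ → ℚ) →
  sumTo m (λ x → doubleSum n (λ i′ k → f i′ k x)) ≡ doubleSum n (λ i′ k → sumTo m (f i′ k))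
doubleSum-swap n m f = trans (sumTo-swap m 4 (λ x i′ → sumTo (suc n) (λ k → f i′ k x)))
  (sumTo-cong 4 (λ i′ → sumTo-swap m (suc n) (λ x k → f i′ k x)))

doubleSum-+- : ∀ n (a b c : ℕ → ℕ → ℚ) →
  doubleSum n (λ i′ k → a i′ k - b i′ k + c i′ k) ≡ doubleSum n a - doubleSum n b + doubleSum n c
doubleSum-+- n a b c = trans (sumTo-cong 4 (λ i′ → split (suc n) (a i′) (b i′) (c i′)))
  (split 4 (λ i′ → sumTo (suc n) (a i′)) (λ i′ → sumTo (suc n) (b i′)) (λ i′ → sumTo (suc n) (c i′)))
  where
  split : ∀ m (f g h : ℕ → ℚ) → sumTo m (λ k → f k - g k + h k) ≡ sumTo m f - sumTo m g + sumTo m h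
  split m f g h = trans (sumTo-+ m (λ k → f k - g k) h) (cong (_+ sumTo m h) (sumTo-- m f g))

-- At t = x + ½ the pole term i (t + k)^-(i+1) equals weight (i − 1) · (2(x + k) + 1)^-(i+1).
weight : ℕ → ℚ
weight i′ = ℕ→ℚ (suc i′) * pow2 (suc (suc i′))

Rn′-expansion : ∀ n r → IsPartialFraction n r → ∀ x →
  Rn′ n (ℕ→ℚ x + ½) ≡ - doubleSum n (λ i′ k → weight i′ * r (suc i′) k * invOddPow (suc (suc i′)) (k ℕ.+ x))
Rn′-expansion n r isPF x = trans (Rn′-halfInteger n r isPF x) (cong -_ (doubleSum-cong n term≡))
  where
  term≡ : ∀ i′ k → ℕ→ℚ (suc i′) * r (suc i′) k * inv (pow (ℕ→ℚ x + ½ + ℕ→ℚ k) (suc (suc i′)))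
                 ≡ weight i′ * r (suc i′) k * invOddPow (suc (suc i′)) (k ℕ.+ x)
  term≡ i′ k = begin
    m * r (suc i′) k * inv (pow (ℕ→ℚ x + ½ + ℕ→ℚ k) (suc (suc i′)))
      ≡⟨ cong (λ z → m * r (suc i′) k * inv (pow z (suc (suc i′))))
           (trans (halfInteger-+ x k) (cong (λ z → ½ * oddℚ z) (ℕP.+-comm x k))) ⟩
    m * r (suc i′) k * inv (pow (½ * oddℚ (k ℕ.+ x)) (suc (suc i′)))
      ≡⟨ cong (m * r (suc i′) k *_) (inv-pow-half (oddℚ (k ℕ.+ x)) (suc (suc i′)) (oddℚ-≢0 (k ℕ.+ x))) ⟩
    m * r (suc i′) k * (pow2 (suc (suc i′)) * invOddPow (suc (suc i′)) (k ℕ.+ x))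
      ≡⟨ lemma m (r (suc i′) k) (pow2 (suc (suc i′))) (invOddPow (suc (suc i′)) (k ℕ.+ x)) ⟩
    weight i′ * r (suc i′) k * invOddPow (suc (suc i′)) (k ℕ.+ x) ∎
    where
    m = ℕ→ℚ (suc i′)
    lemma : ∀ a b c d → a * b * (c * d) ≡ a * c * b * d
    lemma = solve 4 (λ a b c d → a :* b :* (c :* d) := a :* c :* b :* d) refl

shiftedMean : ℕ → ℕ → ℕ → ℚ
shiftedMean N m k = inv (pow2 N) * sumTo (2 ^ N) (λ x → invOddPow m (k ℕ.+ x))

SnApprox≡ : ∀ n r → IsPartialFraction n r → ∀ N →
  SnApprox n N ≡ doubleSum n (λ i′ k → weight i′ * r (suc i′) k * shiftedMean N (suc (suc i′)) k)
SnApprox≡ n r isPF N = begin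
  - (i * sumTo (2 ^ N) (λ x → Rn′ n (ℕ→ℚ x + ½)))
    ≡⟨ cong (λ z → - (i * z)) (trans (sumTo-cong (2 ^ N) (Rn′-expansion n r isPF)) (sumTo-neg (2 ^ N) (λ x → doubleSum n (g x)))) ⟩
  - (i * - sumTo (2 ^ N) (λ x → doubleSum n (g x)))
    ≡⟨ solve 2 (λ a b → :- (a :* :- b) := a :* b) refl i (sumTo (2 ^ N) (λ x → doubleSum n (g x))) ⟩
  i * sumTo (2 ^ N) (λ x → doubleSum n (g x))
    ≡⟨ cong (i *_) (doubleSum-swap n (2 ^ N) (λ i′ k x → g x i′ k)) ⟩
  i * doubleSum n (λ i′ k → sumTo (2 ^ N) (λ x → g x i′ k))
    ≡⟨ sym (doubleSum-*ˡ n i (λ i′ k → sumTo (2 ^ N) (λ x → g x i′ k))) ⟩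
  doubleSum n (λ i′ k → i * sumTo (2 ^ N) (λ x → g x i′ k))
    ≡⟨ doubleSum-cong n (λ i′ k → trans (cong (i *_) (sumTo-*ˡ (2 ^ N) (c i′ k) (P i′ k)))
                                        (ℚ*.x∙yz≈y∙xz i (c i′ k) (sumTo (2 ^ N) (P i′ k)))) ⟩
  doubleSum n (λ i′ k → weight i′ * r (suc i′) k * shiftedMean N (suc (suc i′)) k) ∎
  where
  i = inv (pow2 N)
  g : ℕ → ℕ → ℕ → ℚ
  g x i′ k = weight i′ * r (suc i′) k * invOddPow (suc (suc i′)) (k ℕ.+ x)
  c : ℕ → ℕ → ℚ
  c i′ k = weight i′ * r (suc i′) k
  P : ℕ → ℕ → ℕ → ℚ
  P i′ k x = invOddPow (suc (suc i′)) (k ℕ.+ x)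

shiftCorrection : ℕ → ℕ → ℚ
shiftCorrection j k = ℕ→ℚ 2 * ℕ→ℚ (suc j) * sumTo k (invOddPow (suc (suc j)))

shiftError : ℕ → ℕ → ℕ → ℚ
shiftError N j k = ℕ→ℚ 4 * pow2 N * sumTo k (oddRem N j)

shiftedMean≡ : ∀ N j k → shiftedMean N (suc j) k ≡ oddMean N (suc j) - shiftCorrection j k + shiftError N j k
shiftedMean≡ N j k = begin
  i * sumTo (2 ^ N) (λ x → P (k ℕ.+ x))
    ≡⟨ cong (i *_) (sumTo-shift (2 ^ N) k P) ⟩
  i * (E + sumTo k (λ ℓ → P (ℓ ℕ.+ 2 ^ N) - P ℓ))
    ≡⟨ cong (λ z → i * (E + z)) (sumTo-cong k increment≡) ⟩
  i * (E + sumTo k (λ ℓ → - (c * P′ ℓ) + d * oddRem N j ℓ))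
    ≡⟨ cong (λ z → i * (E + z)) (trans (sumTo-+ k (λ ℓ → - (c * P′ ℓ)) (λ ℓ → d * oddRem N j ℓ))
         (cong₂ _+_ (trans (sumTo-neg k (λ ℓ → c * P′ ℓ)) (cong -_ (sumTo-*ˡ k c P′))) (sumTo-*ˡ k d (oddRem N j)))) ⟩
  i * (E + (- (c * sumTo k P′) + d * sumTo k (oddRem N j)))
    ≡⟨ lemma i h E (ℕ→ℚ (suc j)) (sumTo k P′) (sumTo k (oddRem N j)) ⟩
  i * E - (i * h) * shiftCorrection j k + (i * h) * shiftError N j k
    ≡⟨ cong (λ z → i * E - z * shiftCorrection j k + z * shiftError N j k) (*-invˡ h (pow2-≢0 N)) ⟩
  i * E - 1ℚ * shiftCorrection j k + 1ℚ * shiftError N j k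
    ≡⟨ cong₂ (λ a b → i * E - a + b) (ℚP.*-identityˡ (shiftCorrection j k)) (ℚP.*-identityˡ (shiftError N j k)) ⟩
  oddMean N (suc j) - shiftCorrection j k + shiftError N j k ∎
  where
  h = pow2 N
  i = inv h
  P = invOddPow (suc j)
  P′ = invOddPow (suc (suc j))
  E = oddSum N (suc j)
  c = ℕ→ℚ (suc j) * pow2 (suc N)
  d = pow2 (suc N) * pow2 (suc N)
  increment≡ : ∀ ℓ → P (ℓ ℕ.+ 2 ^ N) - P ℓ ≡ - (c * P′ ℓ) + d * oddRem N j ℓ
  increment≡ ℓ = begin
    P (ℓ ℕ.+ 2 ^ N) - P ℓ
      ≡⟨ cong (λ z → P z - P ℓ) (ℕP.+-comm ℓ (2 ^ N)) ⟩
    P (2 ^ N ℕ.+ ℓ) - P ℓ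
      ≡⟨ cong (_- P ℓ) (invOddPow-shift N j ℓ) ⟩
    P ℓ - c * P′ ℓ + d * oddRem N j ℓ - P ℓ
      ≡⟨ solve 3 (λ a b w → a :- b :+ w :- a := :- b :+ w) refl (P ℓ) (c * P′ ℓ) (d * oddRem N j ℓ) ⟩
    - (c * P′ ℓ) + d * oddRem N j ℓ ∎
  lemma : ∀ i h e m z w → i * (e + (- (m * (ℕ→ℚ 2 * h) * z) + (ℕ→ℚ 2 * h) * (ℕ→ℚ 2 * h) * w))
                        ≡ i * e - (i * h) * (ℕ→ℚ 2 * m * z) + (i * h) * (ℕ→ℚ 4 * h * w)
  lemma = solve 6 (λ i h e m z w →
    i :* (e :+ (:- (m :* (con (ℕ→ℚ 2) :* h) :* z) :+ (con (ℕ→ℚ 2) :* h) :* (con (ℕ→ℚ 2) :* h) :* w))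
    := i :* e :- (i :* h) :* (con (ℕ→ℚ 2) :* m :* z) :+ (i :* h) :* (con (ℕ→ℚ 4) :* h :* w)) refl

shiftError-tends0 : ∀ j k → Tends0₂ (λ N → shiftError N j k)
shiftError-tends0 j k = tends0-fromVal≥ 0 (λ N → subst (Val≥ N 0) (lemma (pow2 N) (sumTo k (oddRem N j)))
  (Val≥-*ℤ₍₂₎ (Val≥-pow2 N) (ℤ₍₂₎-* (ℤ₍₂₎-ℕ 4) (ℤ₍₂₎-sumTo k (ℤ₍₂₎-oddRem N j)))))
  where
  lemma : ∀ h W → h * (ℕ→ℚ 4 * W) ≡ ℕ→ℚ 4 * h * W
  lemma = solve 2 (λ h W → h :* (con (ℕ→ℚ 4) :* W) := con (ℕ→ℚ 4) :* h :* W) refl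

halfInteger-pred : ∀ ℓ → ℕ→ℚ (suc ℓ) - ½ ≡ ½ * oddℚ ℓ
halfInteger-pred ℓ = begin
  ℕ→ℚ (suc ℓ) - ½      ≡⟨ cong (_- ½) (ℕ→ℚ-suc ℓ) ⟩
  1ℚ + ℕ→ℚ ℓ - ½       ≡⟨ solve 1 (λ a → con 1ℚ :+ a :- con ½ := a :+ con ½) refl (ℕ→ℚ ℓ) ⟩
  ℕ→ℚ ℓ + ½            ≡⟨ half-oddℚ ℓ ⟩
  ½ * oddℚ ℓ           ∎

rho0≡ : ∀ n r → rho0 n r ≡ - doubleSum n (λ i′ k → weight i′ * r (suc i′) k * shiftCorrection (suc i′) k)
rho0≡ n r = cong -_ (doubleSum-cong n inner≡)
  where
  term≡ : ∀ i′ k ℓ → ℕ→ℚ (suc i′ ℕ.* (suc i′ ℕ.+ 1)) * r (suc i′) k * inv (pow (ℕ→ℚ (suc ℓ) - ½) (suc i′ ℕ.+ 2))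
                   ≡ weight i′ * r (suc i′) k * (ℕ→ℚ 2 * ℕ→ℚ (suc (suc i′))) * invOddPow (suc (suc (suc i′))) ℓ
  term≡ i′ k ℓ = begin
    ℕ→ℚ (suc i′ ℕ.* (suc i′ ℕ.+ 1)) * r (suc i′) k * inv (pow (ℕ→ℚ (suc ℓ) - ½) (suc i′ ℕ.+ 2))
      ≡⟨ cong₂ (λ a b → ℕ→ℚ (suc i′ ℕ.* a) * r (suc i′) k * inv (pow (ℕ→ℚ (suc ℓ) - ½) b))
           (ℕP.+-comm (suc i′) 1) (ℕP.+-comm (suc i′) 2) ⟩
    ℕ→ℚ (suc i′ ℕ.* suc (suc i′)) * r (suc i′) k * inv (pow (ℕ→ℚ (suc ℓ) - ½) (suc (suc (suc i′))))
      ≡⟨ cong₂ (λ a b → a * r (suc i′) k * inv (pow b (suc (suc (suc i′))))) (ℕ→ℚ-* (suc i′) (suc (suc i′))) (halfInteger-pred ℓ) ⟩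
    ℕ→ℚ (suc i′) * ℕ→ℚ (suc (suc i′)) * r (suc i′) k * inv (pow (½ * oddℚ ℓ) (suc (suc (suc i′))))
      ≡⟨ cong (ℕ→ℚ (suc i′) * ℕ→ℚ (suc (suc i′)) * r (suc i′) k *_) (inv-pow-half (oddℚ ℓ) (suc (suc (suc i′))) (oddℚ-≢0 ℓ)) ⟩
    ℕ→ℚ (suc i′) * ℕ→ℚ (suc (suc i′)) * r (suc i′) k * (ℕ→ℚ 2 * pow2 (suc (suc i′)) * invOddPow (suc (suc (suc i′))) ℓ)
      ≡⟨ solve 5 (λ a b c p d → a :* b :* c :* (con (ℕ→ℚ 2) :* p :* d) := a :* p :* c :* (con (ℕ→ℚ 2) :* b) :* d) refl
           (ℕ→ℚ (suc i′)) (ℕ→ℚ (suc (suc i′))) (r (suc i′) k) (pow2 (suc (suc i′))) (invOddPow (suc (suc (suc i′))) ℓ) ⟩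
    weight i′ * r (suc i′) k * (ℕ→ℚ 2 * ℕ→ℚ (suc (suc i′))) * invOddPow (suc (suc (suc i′))) ℓ ∎

  inner≡ : ∀ i′ k → sumTo k (λ ℓ → ℕ→ℚ (suc i′ ℕ.* (suc i′ ℕ.+ 1)) * r (suc i′) k * inv (pow (ℕ→ℚ (suc ℓ) - ½) (suc i′ ℕ.+ 2)))
                  ≡ weight i′ * r (suc i′) k * shiftCorrection (suc i′) k
  inner≡ i′ k = trans (sumTo-cong k (term≡ i′ k)) (trans (sumTo-*ˡ k (a * b) (invOddPow (suc (suc (suc i′)))))
    (ℚP.*-assoc a b (sumTo k (invOddPow (suc (suc (suc i′)))))))
    where
    a = weight i′ * r (suc i′) k
    b = ℕ→ℚ 2 * ℕ→ℚ (suc (suc i′))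

shiftErrors-tends0 : ∀ n (r : ℕ → ℕ → ℚ) →
  Tends0₂ (λ N → doubleSum n (λ i′ k → weight i′ * r (suc i′) k * shiftError N (suc i′) k))
shiftErrors-tends0 n r = tends0-sumTo 4 {λ i′ N → sumTo (suc n) (λ k → weight i′ * r (suc i′) k * shiftError N (suc i′) k)}
  (λ i′ → tends0-sumTo (suc n) (λ k → tends0-*ˡ (weight i′ * r (suc i′) k) (shiftError-tends0 (suc i′) k)))

SnApprox-split : ∀ n r → IsPartialFraction n r → ∀ N →
  SnApprox n N ≡ doubleSum n (λ i′ k → weight i′ * r (suc i′) k * oddMean N (suc (suc i′)))
               - doubleSum n (λ i′ k → weight i′ * r (suc i′) k * shiftCorrection (suc i′) k)
               + doubleSum n (λ i′ k → weight i′ * r (suc i′) k * shiftError N (suc i′) k)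
SnApprox-split n r isPF N = trans (SnApprox≡ n r isPF N) (trans
  (doubleSum-cong n (λ i′ k → trans (cong (c i′ k *_) (shiftedMean≡ N (suc i′) k))
    (solve 4 (λ c a z e → c :* (a :- z :+ e) := c :* a :- c :* z :+ c :* e) refl
      (c i′ k) (oddMean N (suc (suc i′))) (shiftCorrection (suc i′) k) (shiftError N (suc i′) k))))
  (doubleSum-+- n (λ i′ k → c i′ k * oddMean N (suc (suc i′))) (λ i′ k → c i′ k * shiftCorrection (suc i′) k)
                  (λ i′ k → c i′ k * shiftError N (suc i′) k)))
  where
  c : ℕ → ℕ → ℚ
  c i′ k = weight i′ * r (suc i′) k

SnApprox-decomposition : ∀ n r → IsPartialFraction n r → ∀ N → let S = λ i′ → sumTo (suc n) (r (suc i′)) in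
  SnApprox n N - (rho0 n r + rho3 n r * zeta5Approx N)
  ≡ weight 1 * S 1 * oddMean N 3 + weight 3 * S 3 * oddMean N 5
    + doubleSum n (λ i′ k → weight i′ * r (suc i′) k * shiftError N (suc i′) k)
    + weight 2 * S 2 * (oddMean N 4 - oddMean (suc N) 4)
SnApprox-decomposition n r isPF N = begin
  SnApprox n N - (rho0 n r + rho3 n r * zeta5Approx N)
    ≡⟨ cong₂ (λ a b → a - (b + rho3 n r * zeta5Approx N)) (SnApprox-split n r isPF N) (rho0≡ n r) ⟩
  ΣA - ΣZ + ΣW - (- ΣZ + ℕ→ℚ 384 * S 2 * zeta5Approx N)
    ≡⟨ cong₂ (λ a z → a - ΣZ + ΣW - (- ΣZ + ℕ→ℚ 384 * S 2 * z)) ΣA≡ (zeta5Approx≡ N) ⟩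
  0ℚ + w 0 * A 2 * S 0 + w 1 * A 3 * S 1 + w 2 * A 4 * S 2 + w 3 * A 5 * S 3 - ΣZ + ΣW
    - (- ΣZ + ℕ→ℚ 384 * S 2 * (½ * ½ * ½ * oddMean (suc N) 4))
    ≡⟨ cong (λ s → 0ℚ + w 0 * A 2 * s + w 1 * A 3 * S 1 + w 2 * A 4 * S 2 + w 3 * A 5 * S 3 - ΣZ + ΣW
                     - (- ΣZ + ℕ→ℚ 384 * S 2 * (½ * ½ * ½ * oddMean (suc N) 4))) (residue-sum n r isPF) ⟩
  0ℚ + w 0 * A 2 * 0ℚ + w 1 * A 3 * S 1 + w 2 * A 4 * S 2 + w 3 * A 5 * S 3 - ΣZ + ΣW
    - (- ΣZ + ℕ→ℚ 384 * S 2 * (½ * ½ * ½ * oddMean (suc N) 4))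
    ≡⟨⟩
  0ℚ + w 0 * A 2 * 0ℚ + w 1 * A 3 * S 1 + w 2 * A 4 * S 2 + w 3 * A 5 * S 3 - ΣZ + ΣW
    - (- ΣZ + w 2 * ℕ→ℚ 2 * ℕ→ℚ 2 * ℕ→ℚ 2 * S 2 * (½ * ½ * ½ * oddMean (suc N) 4))
    ≡⟨ lemma (w 0) (w 1) (w 2) (w 3) (A 2) (A 3) (A 4) (A 5) (oddMean (suc N) 4) (S 1) (S 2) (S 3) ΣZ ΣW ⟩
  w 1 * S 1 * A 3 + w 3 * S 3 * A 5 + ΣW + w 2 * S 2 * (A 4 - oddMean (suc N) 4) ∎
  where
  S : ℕ → ℚ
  S i′ = sumTo (suc n) (r (suc i′))
  w = weight
  A = oddMean N
  ΣA = doubleSum n (λ i′ k → w i′ * r (suc i′) k * A (suc (suc i′)))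
  ΣZ = doubleSum n (λ i′ k → w i′ * r (suc i′) k * shiftCorrection (suc i′) k)
  ΣW = doubleSum n (λ i′ k → w i′ * r (suc i′) k * shiftError N (suc i′) k)
  ΣA≡ : ΣA ≡ 0ℚ + w 0 * A 2 * S 0 + w 1 * A 3 * S 1 + w 2 * A 4 * S 2 + w 3 * A 5 * S 3
  ΣA≡ = sumTo-cong 4 (λ i′ → trans
    (sumTo-cong (suc n) (λ k → ℚ*.xy∙z≈xz∙y (w i′) (r (suc i′) k) (A (suc (suc i′)))))
    (sumTo-*ˡ (suc n) (w i′ * A (suc (suc i′))) (r (suc i′))))
  lemma : ∀ c0 c1 c2 c3 a2 a3 a4 a5 a4′ s1 s2 s3 Z W →
    0ℚ + c0 * a2 * 0ℚ + c1 * a3 * s1 + c2 * a4 * s2 + c3 * a5 * s3 - Z + W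
      - (- Z + c2 * ℕ→ℚ 2 * ℕ→ℚ 2 * ℕ→ℚ 2 * s2 * (½ * ½ * ½ * a4′))
    ≡ c1 * s1 * a3 + c3 * s3 * a5 + W + c2 * s2 * (a4 - a4′)
  lemma = solve 14 (λ c0 c1 c2 c3 a2 a3 a4 a5 a4′ s1 s2 s3 Z W →
    con 0ℚ :+ c0 :* a2 :* con 0ℚ :+ c1 :* a3 :* s1 :+ c2 :* a4 :* s2 :+ c3 :* a5 :* s3 :- Z :+ W
      :- (:- Z :+ c2 :* con (ℕ→ℚ 2) :* con (ℕ→ℚ 2) :* con (ℕ→ℚ 2) :* s2 :* (con ½ :* con ½ :* con ½ :* a4′))
    := c1 :* s1 :* a3 :+ c3 :* s3 :* a5 :+ W :+ c2 :* s2 :* (a4 :- a4′)) refl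

lemma3p3 : (n : ℕ) (r : ℕ → ℕ → ℚ) → IsPartialFraction n r →
    Tends0₂ (λ N → SnApprox n N - (rho0 n r + rho3 n r * zeta5Approx N))
lemma3p3 n r isPF = tends0-cong (λ N → sym (SnApprox-decomposition n r isPF N))
  (tends0-+ {λ N → mean₃ N + mean₅ N + errors N} {λ N → weight 2 * S 2 * (oddMean N 4 - oddMean (suc N) 4)}
    (tends0-+ {λ N → mean₃ N + mean₅ N} {errors}
      (tends0-+ {mean₃} {mean₅} (tends0-*ˡ (weight 1 * S 1) (oddMean-oddExp-tends0 1))
                          (tends0-*ˡ (weight 3 * S 3) (oddMean-oddExp-tends0 2)))
      (shiftErrors-tends0 n r))
    (tends0-*ˡ (weight 2 * S 2) (oddMean-successive-tends0 3)))
  where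
  S : ℕ → ℚ
  S i′ = sumTo (suc n) (r (suc i′))
  mean₃ mean₅ errors : ℕ → ℚ
  mean₃ N = weight 1 * S 1 * oddMean N 3
  mean₅ N = weight 3 * S 3 * oddMean N 5
  errors N = doubleSum n (λ i′ k → weight i′ * r (suc i′) k * shiftError N (suc i′) k)
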